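{- Let $k\in\mathbb Z^+$, $a_1,\ldots,a_k\in\mathbb Z$, $n_1,\ldots,n_k\in\mathbb Z^+$, and suppose the residue classes $a_1(n_1),\ldots,a_k(n_k)$ are pairwise disjoint (i.e. every integer lies in at most one of them). Then $$\sum_{\substack{m_1,\ldots,m_k\in\mathbb Z^+\\ \sum_{s=1}^km_s/n_s=1}}e^{2\pi i\sum_{s=1}^ka_sm_s/n_s}=(-1)^{k-1}.$$
   Context: $a(n)=\{x\in\mathbb Z:x\equiv a\pmod n\}$. -}

module Defs where

open import Level using (Level)
open import Data.Nat as ℕ using (ℕ; zero; suc; NonZero)
open import Data.Fin using (Fin; zero; suc)
open import Data.Vec using (Vec; lookup)
open import Data.Integer as ℤ using (ℤ; +_; -[1+_])
open import Data.Integer.Divisibility as ℤD using ()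
open import Data.Rational as ℚ using (ℚ)
open import Data.List using (List; []; _∷_)
open import Data.Product using (_×_)
open import Relation.Binary.PropositionalEquality using (_≡_)
open import Relation.Nullary using (¬_)
open import Data.Sum using (_⊎_)
open import Algebra.Bundles using (CommutativeRing)

_≡_[mod_] : ℤ → ℤ → ℕ → Set
x ≡ a [mod n ] = (+ n) ℤD.∣ (x ℤ.- a)

PairwiseDisjoint : (k : ℕ) → (Fin k → ℤ) → (Fin k → ℕ) → Set
PairwiseDisjoint k a n =
  ∀ (i j : Fin k) (x : ℤ) → x ≡ a i [mod n i ] → x ≡ a j [mod n j ] → i ≡ j

sumFinℤ : (k : ℕ) → (Fin k → ℤ) → ℤ
sumFinℤ zero f = + 0
sumFinℤ (suc k) f = f zero ℤ.+ sumFinℤ k (λ i → f (suc i))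

sumFinℚ : (k : ℕ) → (Fin k → ℚ) → ℚ
sumFinℚ zero f = ℚ.0ℚ
sumFinℚ (suc k) f = f zero ℚ.+ sumFinℚ k (λ i → f (suc i))

prodFin : (k : ℕ) → (Fin k → ℕ) → ℕ
prodFin zero f = 1
prodFin (suc k) f = f zero ℕ.* prodFin k (λ i → f (suc i))

IsSolution : (k : ℕ) (n : Fin k → ℕ) (nz : ∀ s → NonZero (n s)) → Vec ℕ k → Set
IsSolution k n nz m =
  (∀ s → 1 ℕ.≤ lookup m s) ×
  (sumFinℚ k (λ s → ℚ._/_ (+ lookup m s) (n s) {{nz s}}) ≡ ℚ.1ℚ)

module _ {c ℓ : Level} (R : CommutativeRing c ℓ) where
  open CommutativeRing R

  _^ℕ_ : Carrier → ℕ → Carrier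
  x ^ℕ zero = 1#
  x ^ℕ suc e = x * (x ^ℕ e)

  IsIntegralDomain : Set (c Level.⊔ ℓ)
  IsIntegralDomain = (¬ (1# ≈ 0#)) × (∀ x y → x * y ≈ 0# → (x ≈ 0#) ⊎ (y ≈ 0#))

  IsPrimitiveRoot : ℕ → Carrier → Set ℓ
  IsPrimitiveRoot N ζ = (ζ ^ℕ N ≈ 1#) × (∀ d → 1 ℕ.≤ d → d ℕ.< N → ¬ (ζ ^ℕ d ≈ 1#))

  -- integer powers of an N-th root of unity ζ (ζ⁻¹ = ζ^(N-1))
  rootPow : ℕ → Carrier → ℤ → Carrier
  rootPow N ζ (+ e) = ζ ^ℕ e
  rootPow N ζ -[1+ e ] = (ζ ^ℕ (N ℕ.∸ 1)) ^ℕ (suc e)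

  sumList : List Carrier → Carrier
  sumList [] = 0#
  sumList (x ∷ xs) = x + sumList xs

  -- e^{2πi Σ_s a_s m_s / n_s}, realised as ζ^{Σ_s a_s m_s (N / n_s)} with ζ a
  -- primitive N-th root of unity, N = n_1 ⋯ n_k
  term : (k : ℕ) (a : Fin k → ℤ) (n : Fin k → ℕ) (nz : ∀ s → NonZero (n s))
         (ζ : Carrier) → Vec ℕ k → Carrier
  term k a n nz ζ m =
    rootPow (prodFin k n) ζ
      (sumFinℤ k (λ s → a s ℤ.* (+ (lookup m s ℕ.* ℕ._/_ (prodFin k n) (n s) {{nz s}}))))

  termList : (k : ℕ) (a : Fin k → ℤ) (n : Fin k → ℕ) (nz : ∀ s → NonZero (n s))
             (ζ : Carrier) → List (Vec ℕ k) → List Carrier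
  termList k a n nz ζ [] = []
  termList k a n nz ζ (m ∷ ms) = term k a n nz ζ m ∷ termList k a n nz ζ ms

{-# OPTIONS --safe #-}
-- Let N = n₁ ⋯ n_k, b_s = N / n_s and c_s = ζ^(a_s b_s), with ζ a primitive N-th
-- root of unity.  The sum is the coefficient of X^N in G = ∏_s c_s X^(b_s) / (1 - c_s X^(b_s)).
-- As ζ^(n_s) is a primitive b_s-th root of unity, 1 - c_s X^(b_s) = ∏ (1 - ζ^t X) over the
-- t < N in the class a_s (n_s).  The classes being disjoint, there is a polynomial Q with
-- Q ∏_s (1 - c_s X^(b_s)) = ∏_{t<N} (1 - ζ^t X) = 1 - X^N, so (1 - X^N) G = Q ∏_s c_s X^(Σ b_s).
-- Comparing coefficients of X^N in these two identities gives G_N = lead(Q) ∏_s c_s and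
-- -1 = lead(Q) ∏_s (-c_s), whence G_N = (-1)^(k-1).
module Submission where

open import Defs
open import Level using (Level; _⊔_)
open import Algebra.Bundles using (CommutativeRing)
open import Data.Empty using (⊥-elim)
open import Data.Fin using (Fin; zero; suc; toℕ)
import Data.Fin.Properties as Finₚ
open import Data.Integer using (ℤ)
import Data.Integer as ℤ
import Data.Integer.Properties as ℤₚ
import Data.Integer.Solver as ℤ-Solver
open import Data.List using (List; []; _∷_; [_]; _++_; map; length; filter; foldr; applyUpTo)
import Data.List.Properties as Listₚ
open import Data.List.Membership.Propositional using (_∈_)
open import Data.List.Membership.Propositional.Properties
  using (∈-map⁺; ∈-map⁻; ∈-++⁺ˡ; ∈-++⁺ʳ; ∈-++⁻; ∈-applyUpTo⁺; ∈-applyUpTo⁻; ∈-filter⁺; ∈-filter⁻)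
open import Data.List.Membership.Propositional.Properties.WithK using (unique∧set⇒bag)
open import Data.List.Relation.Binary.BagAndSetEquality using (∼bag⇒↭)
import Data.List.Relation.Binary.Permutation.Propositional as ↭
import Data.List.Relation.Binary.Permutation.Propositional.Properties as ↭ₚ
open import Data.List.Relation.Binary.Pointwise as Pointwise using (Pointwise; []; _∷_)
import Data.List.Relation.Unary.All as All
open import Data.List.Relation.Unary.AllPairs using ([]; _∷_)
open import Data.List.Relation.Unary.Any using (here)
open import Data.List.Relation.Unary.Unique.Propositional using (Unique)
import Data.List.Relation.Unary.Unique.Propositional.Properties as Unique
open import Data.Nat as ℕ using (ℕ; NonZero; zero; suc; _≤_; _<_; _∸_; z≤n; s≤s; _≤?_)
import Data.Nat.Divisibility as ℕ∣
import Data.Nat.Properties as ℕₚ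
import Data.Nat.Solver as ℕ-Solver
open import Data.List.Membership.DecPropositional ℕₚ._≟_ using (_∈?_; _∉?_)
open import Data.Product using (_×_; _,_; proj₁; proj₂; ∃)
open import Data.Rational as ℚ using ()
import Data.Rational.Properties as ℚₚ
open import Data.Rational.Unnormalised as ℚᵘ using (mkℚᵘ; *≡*)
import Data.Rational.Unnormalised.Properties as ℚᵘₚ
open import Data.Sum using (_⊎_; inj₁; inj₂)
open import Data.Vec using (Vec; []; _∷_; lookup)
import Data.Vec.Functional as Vector
open import Function using (_∘_)
open import Function.Bundles using (_⇔_; mk⇔; Equivalence)
open import Relation.Binary.Bundles using (Setoid)
open import Relation.Binary.Definitions using (tri<; tri≈; tri>)
open import Relation.Binary.PropositionalEquality as ≡ using (_≡_)
import Relation.Binary.Reasoning.Setoid as SetoidReasoning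
open import Relation.Nullary using (¬_; yes; no)

open ↭ using (_↭_)

unique-↭ : ∀ {a} {A : Set a} {xs ys : List A} → Unique xs → Unique ys →
           (∀ z → (z ∈ xs) ⇔ (z ∈ ys)) → xs ↭ ys
unique-↭ xs! ys! same = ∼bag⇒↭ (unique∧set⇒bag xs! ys! (λ {z} → same z))

nonZero-factorʳ : ∀ m {n N} .{{_ : NonZero N}} → m ℕ.* n ≡ N → NonZero n
nonZero-factorʳ m {{N≢0}} m*n≡N = ℕₚ.m*n≢0⇒n≢0 m {{≡.subst NonZero (≡.sym m*n≡N) N≢0}}

sumFinℕ : (k : ℕ) → (Fin k → ℕ) → ℕ
sumFinℕ zero    b = 0
sumFinℕ (suc k) b = b zero ℕ.+ sumFinℕ k (b ∘ suc)

module Solutions where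
  open ≡ using (refl)
  open import Data.Nat using (_+_; _*_)

  weightedSum : (k : ℕ) → (Fin k → ℕ) → Vec ℕ k → ℕ
  weightedSum zero    b []      = 0
  weightedSum (suc k) b (x ∷ m) = x * b zero + weightedSum k (b ∘ suc) m

  Solution : (k : ℕ) → (Fin k → ℕ) → ℕ → Vec ℕ k → Set
  Solution k b j m = (∀ s → 1 ≤ lookup m s) × (weightedSum k b m ≡ j)

  incrementHead : ∀ {k} → Vec ℕ (suc k) → Vec ℕ (suc k)
  incrementHead (x ∷ m) = suc x ∷ m

  -- A solution either has m₀ = 1 or comes from a solution for j ∸ b₀ by
  -- incrementing m₀.  The fuel only bounds the recursion: it is irrelevant as
  -- soon as it is at least j (solutions-fuel-↭).
  solutions : (fuel k : ℕ) → (Fin k → ℕ) → ℕ → List (Vec ℕ k)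
  solutions _        zero    b zero    = [ [] ]
  solutions _        zero    b (suc j) = []
  solutions zero     (suc k) b j       = []
  solutions (suc F) (suc k) b j with b zero ≤? j
  ... | no  _ = []
  ... | yes _ = map (1 ∷_) (solutions F k (b ∘ suc) (j ∸ b zero))
             ++ map incrementHead (solutions F (suc k) b (j ∸ b zero))

  positive-∷ : ∀ {k x} {m : Vec ℕ k} → 1 ≤ x → (∀ s → 1 ≤ lookup m s) → ∀ s → 1 ≤ lookup (x ∷ m) s
  positive-∷ x≥1 pos zero    = x≥1
  positive-∷ x≥1 pos (suc s) = pos s

  ∸-cancelˡ : ∀ {a w j} → a + w ≡ j → w ≡ j ∸ a
  ∸-cancelˡ {a} {w} a+w≡j = ≡.trans (≡.sym (ℕₚ.m+n∸m≡n a w)) (≡.cong (_∸ a) a+w≡j)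

  fuel-decreases : ∀ {F j b} → 1 ≤ b → b ≤ j → j ≤ suc F → j ∸ b ≤ F
  fuel-decreases b≥1 b≤j j≤1+F = ℕₚ.≤-pred (ℕₚ.≤-trans (ℕₚ.∸-monoʳ-< b≥1 b≤j) j≤1+F)

  solutions-sound : ∀ F k b j m → m ∈ solutions F k b j → Solution k b j m
  solutions-sound F zero b zero [] (here refl) = (λ ()) , refl
  solutions-sound (suc F) (suc k) b j m m∈ with b zero ≤? j
  ... | yes b₀≤j with ∈-++⁻ (map (1 ∷_) (solutions F k (b ∘ suc) (j ∸ b zero))) m∈
  ...   | inj₁ m∈₁ with ∈-map⁻ (1 ∷_) m∈₁
  ...     | m′ , m′∈ , refl with solutions-sound F k (b ∘ suc) (j ∸ b zero) m′ m′∈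
  ...       | pos , sum≡ = positive-∷ (s≤s z≤n) pos
                         , ≡.trans (≡.cong₂ _+_ (ℕₚ.+-identityʳ (b zero)) sum≡) (ℕₚ.m+[n∸m]≡n b₀≤j)
  solutions-sound (suc F) (suc k) b j m m∈ | yes b₀≤j | inj₂ m∈₂ with ∈-map⁻ incrementHead m∈₂
  ... | x ∷ m′ , m′∈ , refl with solutions-sound F (suc k) b (j ∸ b zero) (x ∷ m′) m′∈
  ...   | pos , sum≡ = positive-∷ (s≤s z≤n) (pos ∘ suc)
                     , ≡.trans (ℕₚ.+-assoc (b zero) (x * b zero) _)
                               (≡.trans (≡.cong (b zero +_) sum≡) (ℕₚ.m+[n∸m]≡n b₀≤j))

  head≤weightedSum : ∀ k b x m → 1 ≤ x → b zero ≤ weightedSum (suc k) b (x ∷ m)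
  head≤weightedSum k b (suc x) m _ = ℕₚ.≤-trans (ℕₚ.m≤m+n (b zero) (x * b zero)) (ℕₚ.m≤m+n _ _)

  solutions-complete : ∀ F k b → (∀ s → 1 ≤ b s) → ∀ j → j ≤ F →
                       ∀ m → Solution k b j m → m ∈ solutions F k b j
  solutions-complete F zero b _ zero _ [] _ = here refl
  solutions-complete F zero b _ (suc j) _ [] (_ , ())
  solutions-complete zero (suc k) b b≥1 zero _ (x ∷ m) (pos , sum≡) =
    ⊥-elim (ℕₚ.<⇒≢ (ℕₚ.<-≤-trans (b≥1 zero) (head≤weightedSum k b x m (pos zero))) (≡.sym sum≡))
  solutions-complete (suc F) (suc k) b b≥1 j j≤F (x ∷ m) (pos , sum≡) with b zero ≤? j
  ... | no b₀≰j = ⊥-elim (b₀≰j (≡.subst (b zero ≤_) sum≡ (head≤weightedSum k b x m (pos zero))))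
  ... | yes b₀≤j with x | pos zero
  ...   | suc zero | _ = ∈-++⁺ˡ (∈-map⁺ (1 ∷_)
    (solutions-complete F k (b ∘ suc) (b≥1 ∘ suc) (j ∸ b zero) (fuel-decreases (b≥1 zero) b₀≤j j≤F) m
      (pos ∘ suc , ∸-cancelˡ {b zero}
        (≡.trans (≡.cong (_+ weightedSum k (b ∘ suc) m) (≡.sym (ℕₚ.+-identityʳ (b zero)))) sum≡))))
  ...   | suc (suc x′) | _ = ∈-++⁺ʳ (map (1 ∷_) (solutions F k (b ∘ suc) (j ∸ b zero))) (∈-map⁺ incrementHead
    (solutions-complete F (suc k) b b≥1 (j ∸ b zero) (fuel-decreases (b≥1 zero) b₀≤j j≤F) (suc x′ ∷ m)
      (positive-∷ (s≤s z≤n) (pos ∘ suc) , ∸-cancelˡ {b zero}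
        (≡.trans (≡.sym (ℕₚ.+-assoc (b zero) (suc x′ * b zero) _)) sum≡))))

  solutions-unique : ∀ F k b j → Unique (solutions F k b j)
  solutions-unique F zero b zero = All.[] ∷ []
  solutions-unique F zero b (suc j) = []
  solutions-unique zero (suc k) b j = []
  solutions-unique (suc F) (suc k) b j with b zero ≤? j
  ... | no  _ = []
  ... | yes _ = Unique.++⁺ (Unique.map⁺ ∷-injectiveʳ (solutions-unique F k (b ∘ suc) _))
                           (Unique.map⁺ incrementHead-injective (solutions-unique F (suc k) b _))
                           disjoint
    where
    ∷-injectiveʳ : ∀ {x y : Vec ℕ k} → (1 ∷ x) ≡ (1 ∷ y) → x ≡ y
    ∷-injectiveʳ refl = refl
    incrementHead-injective : ∀ {x y : Vec ℕ (suc k)} → incrementHead x ≡ incrementHead y → x ≡ y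
    incrementHead-injective {_ ∷ _} {_ ∷ _} refl = refl
    disjoint : ∀ {v} → ¬ (v ∈ map (1 ∷_) (solutions F k (b ∘ suc) (j ∸ b zero))
                          × v ∈ map incrementHead (solutions F (suc k) b (j ∸ b zero)))
    disjoint (v∈₁ , v∈₂) with ∈-map⁻ (1 ∷_) v∈₁ | ∈-map⁻ incrementHead v∈₂
    ... | _ , _ , refl | (x ∷ _) , y∈ , eq with solutions-sound F (suc k) b _ _ y∈
    ...   | pos , _ with x | pos zero | eq
    ...     | suc _ | _ | ()

  solutions-fuel-↭ : ∀ F F′ k b → (∀ s → 1 ≤ b s) → ∀ j → j ≤ F → j ≤ F′ →
                     solutions F k b j ↭ solutions F′ k b j
  solutions-fuel-↭ F F′ k b b≥1 j j≤F j≤F′ =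
    unique-↭ (solutions-unique F k b j) (solutions-unique F′ k b j) λ m → mk⇔
      (solutions-complete F′ k b b≥1 j j≤F′ m ∘ solutions-sound F k b j m)
      (solutions-complete F k b b≥1 j j≤F m ∘ solutions-sound F′ k b j m)

module Residues where
  open ≡ using (refl)
  open import Data.Nat using (_+_; _*_)

  progression : ℕ → ℕ → ℕ → List ℕ
  progression a d = applyUpTo (λ i → a + i * d)

  progression-unique : ∀ a d .{{_ : NonZero d}} b → Unique (progression a d b)
  progression-unique a d b = Unique.applyUpTo⁺₁ _ b λ i<j _ eq →
    ℕₚ.<⇒≢ i<j (ℕₚ.*-cancelʳ-≡ _ _ d (ℕₚ.+-cancelˡ-≡ a _ _ eq))

  -- the members t < N of the classes α s (n s), where N = n s * b s
  residues : (k : ℕ) → (α n b : Fin k → ℕ) → List ℕ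
  residues zero    α n b = []
  residues (suc k) α n b =
    progression (α zero) (n zero) (b zero) ++ residues k (α ∘ suc) (n ∘ suc) (b ∘ suc)

  ∈-residues⁻ : ∀ k α n b {t} → t ∈ residues k α n b →
                ∃ λ s → ∃ λ i → i < b s × t ≡ α s + i * n s
  ∈-residues⁻ (suc k) α n b t∈ with ∈-++⁻ (progression (α zero) (n zero) (b zero)) t∈
  ... | inj₁ t∈₁ with ∈-applyUpTo⁻ _ t∈₁
  ...   | i , i<b , t≡ = zero , i , i<b , t≡
  ∈-residues⁻ (suc k) α n b t∈ | inj₂ t∈₂ with ∈-residues⁻ k (α ∘ suc) (n ∘ suc) (b ∘ suc) t∈₂
  ...   | s , i , i<b , t≡ = suc s , i , i<b , t≡

  length-residues : ∀ k α n b → length (residues k α n b) ≡ sumFinℕ k b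
  length-residues zero    α n b = refl
  length-residues (suc k) α n b = ≡.trans (Listₚ.length-++ (progression (α zero) (n zero) (b zero)))
    (≡.cong₂ _+_ (Listₚ.length-applyUpTo _ (b zero)) (length-residues k (α ∘ suc) (n ∘ suc) (b ∘ suc)))

  DisjointProgressions : (k : ℕ) → (α n b : Fin k → ℕ) → Set
  DisjointProgressions k α n b =
    ∀ s r i j → i < b s → j < b r → α s + i * n s ≡ α r + j * n r → s ≡ r

  residues-unique : ∀ k α n b → (∀ s → NonZero (n s)) → DisjointProgressions k α n b →
                    Unique (residues k α n b)
  residues-unique zero    α n b _  _        = []
  residues-unique (suc k) α n b nz disjoint =
    Unique.++⁺ (progression-unique (α zero) (n zero) {{nz zero}} (b zero))
               (residues-unique k _ _ _ (nz ∘ suc) (λ s r i j i<b j<b eq →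
                  Finₚ.suc-injective (disjoint (suc s) (suc r) i j i<b j<b eq)))
               apart
    where
    apart : ∀ {t} → ¬ (t ∈ progression (α zero) (n zero) (b zero)
                       × t ∈ residues k (α ∘ suc) (n ∘ suc) (b ∘ suc))
    apart (t∈₁ , t∈₂) with ∈-applyUpTo⁻ _ t∈₁ | ∈-residues⁻ k _ _ _ t∈₂
    ... | i , i<b , t≡ | s , j , j<b , t≡′ with disjoint zero (suc s) i j i<b j<b (≡.trans (≡.sym t≡) t≡′)
    ...   | ()

  residues-⊆ : ∀ k α n b N → (∀ s → α s < n s) → (∀ s → n s * b s ≡ N) →
               ∀ {t} → t ∈ residues k α n b → t ∈ progression 0 1 N
  residues-⊆ k α n b N α<n nb≡N {t} t∈ with ∈-residues⁻ k α n b t∈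
  ... | s , i , i<b , refl = ≡.subst (_∈ progression 0 1 N) (ℕₚ.*-identityʳ t) (∈-applyUpTo⁺ _ t<N)
    where
    t<N : t < N
    t<N = ℕₚ.<-≤-trans (ℕₚ.+-monoˡ-< (i * n s) (α<n s))
      (ℕₚ.≤-trans (ℕₚ.*-monoˡ-≤ (n s) i<b) (ℕₚ.≤-reflexive (≡.trans (ℕₚ.*-comm (b s) (n s)) (nb≡N s))))

  complement : List ℕ → List ℕ → List ℕ
  complement ys xs = filter (_∉? xs) ys

  ↭-complement : ∀ {xs ys} → Unique ys → Unique xs → (∀ {t} → t ∈ xs → t ∈ ys) →
                 ys ↭ complement ys xs ++ xs
  ↭-complement {xs} {ys} ys! xs! xs⊆ys =
    unique-↭ ys! (Unique.++⁺ (Unique.filter⁺ (_∉? xs) ys!) xs! apart) λ t → mk⇔ to from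
    where
    apart : ∀ {t} → ¬ (t ∈ complement ys xs × t ∈ xs)
    apart (t∈c , t∈xs) = proj₂ (∈-filter⁻ (_∉? xs) {xs = ys} t∈c) t∈xs
    to : ∀ {t} → t ∈ ys → t ∈ complement ys xs ++ xs
    to {t} t∈ with t ∈? xs
    ... | yes t∈xs = ∈-++⁺ʳ (complement ys xs) t∈xs
    ... | no  t∉xs = ∈-++⁺ˡ (∈-filter⁺ (_∉? xs) t∈ t∉xs)
    from : ∀ {t} → t ∈ complement ys xs ++ xs → t ∈ ys
    from t∈ with ∈-++⁻ (complement ys xs) t∈
    ... | inj₁ t∈c  = proj₁ (∈-filter⁻ (_∉? xs) {xs = ys} t∈c)
    ... | inj₂ t∈xs = xs⊆ys t∈xs

module Rational where
  open import Data.Nat using (_+_; _*_)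
  open import Data.Integer using (+_)
  open ≡ using (refl)
  open Solutions

  toℚᵘ-fraction : ∀ x n .{{_ : NonZero n}} b N′ → n * b ≡ suc N′ →
                  ℚ.toℚᵘ (+ x ℚ./ n) ℚᵘ.≃ mkℚᵘ (+ (x * b)) N′
  toℚᵘ-fraction x (suc n′) b N′ nb≡N = ℚᵘₚ.≃-trans (ℚₚ.toℚᵘ-fromℚᵘ (mkℚᵘ (+ x) n′)) (*≡* (begin
    + x ℤ.* + suc N′            ≡⟨ ℤₚ.pos-* x (suc N′) ⟨
    + (x * suc N′)              ≡⟨ ≡.cong (λ N → + (x * N)) nb≡N ⟨
    + (x * (suc n′ * b))        ≡⟨ ≡.cong +_ (solve 3 (λ x n b → x :* (n :* b) := (x :* b) :* n) refl x (suc n′) b) ⟩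
    + (x * b * suc n′)          ≡⟨ ℤₚ.pos-* (x * b) (suc n′) ⟩
    + (x * b) ℤ.* + suc n′      ∎))
    where
    open ≡.≡-Reasoning
    open ℕ-Solver.+-*-Solver

  mkℚᵘ-+ : ∀ p q N′ → mkℚᵘ p N′ ℚᵘ.+ mkℚᵘ q N′ ℚᵘ.≃ mkℚᵘ (p ℤ.+ q) N′
  mkℚᵘ-+ p q N′ = *≡* (≡.trans
    (solve 3 (λ p q N → (p :* N :+ q :* N) :* N := (p :+ q) :* (N :* N)) refl p q (+ suc N′))
    (≡.cong ((p ℤ.+ q) ℤ.*_) (≡.sym (ℤₚ.pos-* (suc N′) (suc N′)))))
    where open ℤ-Solver.+-*-Solver

  toℚᵘ-sum-fractions : ∀ k (n : Fin k → ℕ) (nz : ∀ s → NonZero (n s)) (b : Fin k → ℕ) N′ →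
                       (∀ s → n s * b s ≡ suc N′) → ∀ m →
    ℚ.toℚᵘ (sumFinℚ k (λ s → ℚ._/_ (+ lookup m s) (n s) {{nz s}})) ℚᵘ.≃ mkℚᵘ (+ weightedSum k b m) N′
  toℚᵘ-sum-fractions zero    n nz b N′ nb≡N []      = *≡* refl
  toℚᵘ-sum-fractions (suc k) n nz b N′ nb≡N (x ∷ m) = begin
    ℚ.toℚᵘ (ℚ._/_ (+ x) (n zero) {{nz zero}} ℚ.+ rest)
      ≈⟨ ℚₚ.toℚᵘ-homo-+ (ℚ._/_ (+ x) (n zero) {{nz zero}}) rest ⟩
    ℚ.toℚᵘ (ℚ._/_ (+ x) (n zero) {{nz zero}}) ℚᵘ.+ ℚ.toℚᵘ rest
      ≈⟨ ℚᵘₚ.+-cong (toℚᵘ-fraction x (n zero) {{nz zero}} (b zero) N′ (nb≡N zero))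
                    (toℚᵘ-sum-fractions k (n ∘ suc) (nz ∘ suc) (b ∘ suc) N′ (nb≡N ∘ suc) m) ⟩
    mkℚᵘ (+ (x * b zero)) N′ ℚᵘ.+ mkℚᵘ (+ weightedSum k (b ∘ suc) m) N′
      ≈⟨ mkℚᵘ-+ (+ (x * b zero)) (+ weightedSum k (b ∘ suc) m) N′ ⟩
    mkℚᵘ (+ (x * b zero) ℤ.+ + weightedSum k (b ∘ suc) m) N′
      ≡⟨ ≡.cong (λ p → mkℚᵘ p N′) (ℤₚ.pos-+ (x * b zero) _) ⟨
    mkℚᵘ (+ weightedSum (suc k) b (x ∷ m)) N′ ∎
    where
    open ℚᵘₚ.≃-Reasoning
    rest : ℚ.ℚ
    rest = sumFinℚ k (λ s → ℚ._/_ (+ lookup m s) (n (suc s)) {{nz (suc s)}})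

  IsSolution⇔Solution : ∀ k (n : Fin k → ℕ) (nz : ∀ s → NonZero (n s)) (b : Fin k → ℕ) N .{{_ : NonZero N}} →
                        (∀ s → n s * b s ≡ N) → ∀ m → IsSolution k n nz m ⇔ Solution k b N m
  IsSolution⇔Solution k n nz b (suc N′) nb≡N m = mk⇔
    (λ (pos , sum≡1) → pos , ℤₚ.+-injective (begin
       + weightedSum k b m           ≡⟨ ℤₚ.*-identityʳ _ ⟨
       + weightedSum k b m ℤ.* + 1   ≡⟨ ℚᵘₚ.drop-*≡* (ℚᵘₚ.≃-trans (ℚᵘₚ.≃-sym sum≃)
                                                                 (ℚᵘₚ.≃-reflexive (≡.cong ℚ.toℚᵘ sum≡1))) ⟩
       + 1 ℤ.* + suc N′              ≡⟨ ℤₚ.*-identityˡ _ ⟩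
       + suc N′                      ∎))
    (λ (pos , sum≡N) → pos , ℚₚ.toℚᵘ-injective (ℚᵘₚ.≃-trans sum≃ (*≡* (≡.trans (ℤₚ.*-identityʳ _)
                                                    (≡.trans (≡.cong +_ sum≡N) (≡.sym (ℤₚ.*-identityˡ _)))))))
    where
    open ≡.≡-Reasoning
    sum≃ : ℚ.toℚᵘ (sumFinℚ k (λ s → ℚ._/_ (+ lookup m s) (n s) {{nz s}})) ℚᵘ.≃ mkℚᵘ (+ weightedSum k b m) N′
    sum≃ = toℚᵘ-sum-fractions k n nz b N′ nb≡N m

module Congruences where
  open import Data.Integer using (+_; -[1+_])
  open import Data.Nat using (_+_; _*_)
  open ≡ using (refl)

  congruent-naturals : ∀ p e q N → + p ≡ + e ℤ.+ q ℤ.* + N →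
                       (∃ λ t → p ≡ e + t * N) ⊎ (∃ λ t → e ≡ p + t * N)
  congruent-naturals p e (+ t) N p≡ = inj₁ (t , ℤₚ.+-injective (begin
    + p                  ≡⟨ p≡ ⟩
    + e ℤ.+ + t ℤ.* + N  ≡⟨ ≡.cong (λ x → + e ℤ.+ x) (ℤₚ.pos-* t N) ⟨
    + e ℤ.+ + (t * N)    ≡⟨ ℤₚ.pos-+ e (t * N) ⟨
    + (e + t * N)        ∎))
    where open ≡.≡-Reasoning
  congruent-naturals p e -[1+ t ] N p≡ = inj₂ (suc t , ℤₚ.+-injective (begin
    + e                                    ≡⟨ solve 2 (λ e m → e := (e :- m) :+ m) refl (+ e) (+ (suc t * N)) ⟩
    + e ℤ.- + (suc t * N) ℤ.+ + (suc t * N) ≡⟨ ≡.cong (ℤ._+ + (suc t * N)) p≡′ ⟨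
    + p ℤ.+ + (suc t * N)                  ≡⟨ ℤₚ.pos-+ p (suc t * N) ⟨
    + (p + suc t * N)                      ∎))
    where
    open ≡.≡-Reasoning
    open ℤ-Solver.+-*-Solver
    p≡′ : + p ≡ + e ℤ.- + (suc t * N)
    p≡′ = ≡.trans p≡ (≡.cong (λ x → + e ℤ.+ x) (≡.trans (≡.sym (ℤₚ.neg-distribˡ-* (+ suc t) (+ N)))
                                                       (≡.cong ℤ.-_ (≡.sym (ℤₚ.pos-* (suc t) N)))))

  -- rootPow encodes ζ ^ -[1+ p ] as (ζ ^ (N ∸ 1)) ^ suc p.
  negative-exponent : ∀ p e q N′ → -[1+ p ] ≡ + e ℤ.+ q ℤ.* + suc N′ →
                      + (N′ * suc p) ≡ + e ℤ.+ (q ℤ.+ + suc p) ℤ.* + suc N′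
  negative-exponent p e q N′ eq = begin
    + (N′ * suc p)                                  ≡⟨ ℤₚ.pos-* N′ (suc p) ⟩
    + N′ ℤ.* + suc p
      ≡⟨ solve 2 (λ n p → n :* (one :+ p) := :- (one :+ p) :+ (one :+ p) :* (one :+ n))
                                                                refl (+ N′) (+ p) ⟩
    -[1+ p ] ℤ.+ + suc p ℤ.* + suc N′               ≡⟨ ≡.cong (ℤ._+ + suc p ℤ.* + suc N′) eq ⟩
    + e ℤ.+ q ℤ.* + suc N′ ℤ.+ + suc p ℤ.* + suc N′ ≡⟨ solve 4 (λ e q p n → e :+ q :* n :+ p :* n := e :+ (q :+ p) :* n)
                                                                refl (+ e) q (+ suc p) (+ suc N′) ⟩
    + e ℤ.+ (q ℤ.+ + suc p) ℤ.* + suc N′            ∎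
    where
    open ≡.≡-Reasoning
    open ℤ-Solver.+-*-Solver
    one : Polynomial 2
    one = con (+ 1)

  exponent : (k : ℕ) → (Fin k → ℕ) → (Fin k → ℕ) → Vec ℕ k → ℕ
  exponent zero    α b []      = 0
  exponent (suc k) α b (x ∷ m) = α zero * (x * b zero) + exponent k (α ∘ suc) (b ∘ suc) m

  exponent-congruent : ∀ k (a : Fin k → ℤ) (α : Fin k → ℕ) (q : Fin k → ℤ) (n b : Fin k → ℕ) N →
    (∀ s → a s ≡ + α s ℤ.+ q s ℤ.* + n s) →
    (∀ s → n s * b s ≡ N) → ∀ m →
    ∃ λ Q → sumFinℤ k (λ s → a s ℤ.* + (lookup m s * b s)) ≡ + exponent k α b m ℤ.+ Q ℤ.* + N
  exponent-congruent zero    a α q n b N _  _     []      = + 0 , ≡.refl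
  exponent-congruent (suc k) a α q n b N a≡ nb≡N (x ∷ m)
    with exponent-congruent k (a ∘ suc) (α ∘ suc) (q ∘ suc) (n ∘ suc) (b ∘ suc) N (a≡ ∘ suc) (nb≡N ∘ suc) m
  ... | Q , rest≡ = q zero ℤ.* + x ℤ.+ Q , (begin
    a zero ℤ.* + (x * b zero) ℤ.+ S
      ≡⟨ ≡.cong₂ ℤ._+_ (≡.cong₂ ℤ._*_ (a≡ zero) (ℤₚ.pos-* x (b zero)))
                       (≡.trans rest≡ (≡.cong (λ M → + E ℤ.+ Q ℤ.* M) N≡)) ⟩
    (+ α zero ℤ.+ q zero ℤ.* + n zero) ℤ.* (+ x ℤ.* + b zero) ℤ.+ (+ E ℤ.+ Q ℤ.* (+ n zero ℤ.* + b zero))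
      ≡⟨ solve 7 (λ A q n x b E Q → (A :+ q :* n) :* (x :* b) :+ (E :+ Q :* (n :* b))
                                   := (A :* (x :* b) :+ E) :+ (q :* x :+ Q) :* (n :* b))
                 ≡.refl (+ α zero) (q zero) (+ n zero) (+ x) (+ b zero) (+ E) Q ⟩
    (+ α zero ℤ.* (+ x ℤ.* + b zero) ℤ.+ + E) ℤ.+ (q zero ℤ.* + x ℤ.+ Q) ℤ.* (+ n zero ℤ.* + b zero)
      ≡⟨ ≡.cong₂ ℤ._+_ casts (≡.cong ((q zero ℤ.* + x ℤ.+ Q) ℤ.*_) N≡) ⟨
    + (α zero * (x * b zero) + E) ℤ.+ (q zero ℤ.* + x ℤ.+ Q) ℤ.* + N ∎)
    where
    open ≡.≡-Reasoning
    open ℤ-Solver.+-*-Solver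
    S : ℤ
    S = sumFinℤ k (λ s → a (suc s) ℤ.* + (lookup m s * b (suc s)))
    E : ℕ
    E = exponent k (α ∘ suc) (b ∘ suc) m
    N≡ : + N ≡ + n zero ℤ.* + b zero
    N≡ = ≡.trans (≡.cong +_ (≡.sym (nb≡N zero))) (ℤₚ.pos-* (n zero) (b zero))
    casts : + (α zero * (x * b zero) + E) ≡ + α zero ℤ.* (+ x ℤ.* + b zero) ℤ.+ + E
    casts = ≡.trans (ℤₚ.pos-+ (α zero * (x * b zero)) E)
      (≡.cong (ℤ._+ + E) (≡.trans (ℤₚ.pos-* (α zero) (x * b zero)) (≡.cong (+ α zero ℤ.*_) (ℤₚ.pos-* x (b zero)))))

module Powers {c ℓ} (R : CommutativeRing c ℓ) where
  open CommutativeRing R hiding (zero)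
  open import Algebra.Properties.CommutativeSemiring.Exp commutativeSemiring using (_^_; ^-homo-*; ^-assocʳ)
  open import Data.Integer using (+_; -[1+_])
  open Congruences
  import Algebra.Properties.CommutativeSemigroup ℕₚ.+-commutativeSemigroup as ℕ-+

  ^ℕ≡^ : ∀ x n → _^ℕ_ R x n ≡ x ^ n
  ^ℕ≡^ x zero    = ≡.refl
  ^ℕ≡^ x (suc n) = ≡.cong (x *_) (^ℕ≡^ x n)

  module _ {N ζ} (ζ^N≈1 : ζ ^ N ≈ 1#) where

    ^-periodic : ∀ e t → ζ ^ (e ℕ.+ t ℕ.* N) ≈ ζ ^ e
    ^-periodic e zero    = reflexive (≡.cong (ζ ^_) (ℕₚ.+-identityʳ e))
    ^-periodic e (suc t) = begin
      ζ ^ (e ℕ.+ (N ℕ.+ t ℕ.* N))    ≡⟨ ≡.cong (ζ ^_) (ℕ-+.x∙yz≈y∙xz e N (t ℕ.* N)) ⟩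
      ζ ^ (N ℕ.+ (e ℕ.+ t ℕ.* N))    ≈⟨ ^-homo-* ζ N (e ℕ.+ t ℕ.* N) ⟩
      ζ ^ N * ζ ^ (e ℕ.+ t ℕ.* N)   ≈⟨ *-cong ζ^N≈1 (^-periodic e t) ⟩
      1# * ζ ^ e                    ≈⟨ *-identityˡ _ ⟩
      ζ ^ e                         ∎
      where open SetoidReasoning setoid

    ^-congruent : ∀ p e q → + p ≡ + e ℤ.+ q ℤ.* + N → ζ ^ p ≈ ζ ^ e
    ^-congruent p e q p≡ with congruent-naturals p e q N p≡
    ... | inj₁ (t , p≡e+tN) = trans (reflexive (≡.cong (ζ ^_) p≡e+tN)) (^-periodic e t)
    ... | inj₂ (t , e≡p+tN) = sym (trans (reflexive (≡.cong (ζ ^_) e≡p+tN)) (^-periodic p t))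

  rootPow-congruent : ∀ {N ζ} .{{_ : NonZero N}} → ζ ^ N ≈ 1# →
                      ∀ z e q → z ≡ + e ℤ.+ q ℤ.* + N → rootPow R N ζ z ≈ ζ ^ e
  rootPow-congruent {ζ = ζ} ζ^N≈1 (+ p) e q z≡ = trans (reflexive (^ℕ≡^ ζ p)) (^-congruent ζ^N≈1 p e q z≡)
  rootPow-congruent {suc N′} {ζ} ζ^N≈1 -[1+ p ] e q z≡ = begin
    _^ℕ_ R (_^ℕ_ R ζ N′) (suc p)  ≡⟨ ≡.trans (^ℕ≡^ _ (suc p)) (≡.cong (_^ suc p) (^ℕ≡^ ζ N′)) ⟩
    (ζ ^ N′) ^ suc p              ≈⟨ ^-assocʳ ζ N′ (suc p) ⟩
    ζ ^ (N′ ℕ.* suc p)            ≈⟨ ^-congruent ζ^N≈1 _ e (q ℤ.+ + suc p) (negative-exponent p e q N′ z≡) ⟩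
    ζ ^ e                         ∎
    where open SetoidReasoning setoid

-- A series is its sequence of coefficients; shift multiplies by X, and
-- mulBinomial κ b, mulLinear r multiply by 1 + κ X^b, 1 + r X.
module Series {c ℓ} (R : CommutativeRing c ℓ) where
  open CommutativeRing R hiding (zero)
  open import Algebra.Properties.Semiring.Sum semiring
    using (sum; sum-cong-≋; ∑-distrib-+; *-distribˡ-sum; sum-replicate-zero)
  open import Algebra.Properties.CommutativeSemigroup +-commutativeSemigroup using (interchange)
  open import Algebra.Properties.CommutativeSemigroup *-commutativeSemigroup using (x∙yz≈y∙xz)
  open import Algebra.Properties.CommutativeSemiring.Exp commutativeSemiring using (_^_)

  Series : Set c
  Series = ℕ → Carrier

  infix 4 _≋_
  _≋_ : Series → Series → Set ℓ
  f ≋ g = ∀ n → f n ≈ g n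

  ≋-setoid : Setoid c ℓ
  ≋-setoid = record
    { Carrier       = Series
    ; _≈_           = _≋_
    ; isEquivalence = record
      { refl  = λ _ → refl
      ; sym   = λ f≋g n → sym (f≋g n)
      ; trans = λ f≋g g≋h n → trans (f≋g n) (g≋h n)
      }
    }

  open Setoid ≋-setoid public using ()
    renaming (refl to ≋-refl; sym to ≋-sym; trans to ≋-trans)

  𝟙 : Series
  𝟙 zero    = 1#
  𝟙 (suc _) = 0#

  infixl 6 _⊕_
  _⊕_ : Series → Series → Series
  (f ⊕ g) n = f n + g n

  scale : Carrier → Series → Series
  scale a f n = a * f n

  shift : Series → Series
  shift f zero    = 0#
  shift f (suc n) = f n

  shiftBy : ℕ → Series → Series
  shiftBy zero    f = f
  shiftBy (suc b) f = shift (shiftBy b f)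

  mulBinomial : Carrier → ℕ → Series → Series
  mulBinomial κ b f = f ⊕ scale κ (shiftBy b f)

  mulLinear : Carrier → Series → Series
  mulLinear r = mulBinomial r 1

  mulLinears : List Carrier → Series → Series
  mulLinears rs f = foldr mulLinear f rs

  mulBinomials : (k : ℕ) → (Fin k → Carrier) → (Fin k → ℕ) → Series → Series
  mulBinomials zero    κ b f = f
  mulBinomials (suc k) κ b f = mulBinomial (κ zero) (b zero) (mulBinomials k (κ ∘ suc) (b ∘ suc) f)

  shiftBy-< : ∀ b f {n} → n < b → shiftBy b f n ≡ 0#
  shiftBy-< (suc b) f {zero}  _         = ≡.refl
  shiftBy-< (suc b) f {suc n} (s≤s n<b) = shiftBy-< b f n<b

  shiftBy-≥ : ∀ b f {n} → b ≤ n → shiftBy b f n ≡ f (n ∸ b)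
  shiftBy-≥ zero    f _         = ≡.refl
  shiftBy-≥ (suc b) f (s≤s b≤n) = shiftBy-≥ b f b≤n

  shiftBy-diagonal : ∀ b f → shiftBy b f b ≡ f 0
  shiftBy-diagonal b f = ≡.trans (shiftBy-≥ b f ℕₚ.≤-refl) (≡.cong f (ℕₚ.n∸n≡0 b))

  shiftBy-+ : ∀ b b′ f → shiftBy b (shiftBy b′ f) ≡ shiftBy (b ℕ.+ b′) f
  shiftBy-+ zero    b′ f = ≡.refl
  shiftBy-+ (suc b) b′ f = ≡.cong shift (shiftBy-+ b b′ f)

  -- operators behaving like multiplication by a fixed series
  record IsMultiplier (Φ : Series → Series) : Set (c ⊔ ℓ) where
    field
      cong       : ∀ {f g} → f ≋ g → Φ f ≋ Φ g
      homo-⊕     : ∀ f g → Φ (f ⊕ g) ≋ Φ f ⊕ Φ g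
      homo-scale : ∀ a f → Φ (scale a f) ≋ scale a (Φ f)
      homo-shift : ∀ f → Φ (shift f) ≋ shift (Φ f)

    homo-shiftBy : ∀ b f → Φ (shiftBy b f) ≋ shiftBy b (Φ f)
    homo-shiftBy zero    f         = ≋-refl
    homo-shiftBy (suc b) f zero    = homo-shift _ zero
    homo-shiftBy (suc b) f (suc n) = trans (homo-shift _ (suc n)) (homo-shiftBy b f n)

    commutes-mulBinomial : ∀ κ b f → Φ (mulBinomial κ b f) ≋ mulBinomial κ b (Φ f)
    commutes-mulBinomial κ b f n = trans (homo-⊕ f _ n)
      (+-congˡ (trans (homo-scale κ _ n) (*-congˡ (homo-shiftBy b f n))))

  open IsMultiplier

  ∘-multiplier : ∀ {Φ Ψ} → IsMultiplier Φ → IsMultiplier Ψ → IsMultiplier (Φ ∘ Ψ)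
  ∘-multiplier Φ! Ψ! = record
    { cong       = cong Φ! ∘ cong Ψ!
    ; homo-⊕     = λ f g → ≋-trans (cong Φ! (homo-⊕ Ψ! f g)) (homo-⊕ Φ! _ _)
    ; homo-scale = λ a f → ≋-trans (cong Φ! (homo-scale Ψ! a f)) (homo-scale Φ! a _)
    ; homo-shift = λ f → ≋-trans (cong Φ! (homo-shift Ψ! f)) (homo-shift Φ! _)
    }

  shift-multiplier : IsMultiplier shift
  shift-multiplier = record
    { cong       = λ { f≋g zero → refl ; f≋g (suc n) → f≋g n }
    ; homo-⊕     = λ { f g zero → sym (+-identityʳ 0#) ; f g (suc n) → refl }
    ; homo-scale = λ { a f zero → sym (zeroʳ a) ; a f (suc n) → refl }
    ; homo-shift = λ _ _ → refl
    }

  shiftBy-multiplier : ∀ b → IsMultiplier (shiftBy b)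
  shiftBy-multiplier zero    = record
    { cong = λ f≋g → f≋g ; homo-⊕ = λ _ _ → ≋-refl ; homo-scale = λ _ _ → ≋-refl ; homo-shift = λ _ → ≋-refl }
  shiftBy-multiplier (suc b) = ∘-multiplier shift-multiplier (shiftBy-multiplier b)

  mulBinomial-multiplier : ∀ κ b → IsMultiplier (mulBinomial κ b)
  mulBinomial-multiplier κ b = record
    { cong       = λ f≋g n → +-cong (f≋g n) (*-congˡ (cong X^b f≋g n))
    ; homo-⊕     = λ f g n → trans (+-congˡ (trans (*-congˡ (homo-⊕ X^b f g n)) (distribˡ κ _ _)))
                                   (interchange _ _ _ _)
    ; homo-scale = λ a f n → trans (+-congˡ (trans (*-congˡ (homo-scale X^b a f n)) (x∙yz≈y∙xz κ a _)))
                                   (sym (distribˡ a _ _))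
    ; homo-shift = λ f n → trans (+-congˡ (*-congˡ (homo-shift X^b f n)))
                                 (sym (trans (homo-⊕ shift-multiplier f _ n)
                                             (+-congˡ (homo-scale shift-multiplier κ _ n))))
    }
    where
    X^b : IsMultiplier (shiftBy b)
    X^b = shiftBy-multiplier b

  mulLinears-multiplier : ∀ rs → IsMultiplier (mulLinears rs)
  mulLinears-multiplier []       = shiftBy-multiplier 0
  mulLinears-multiplier (r ∷ rs) = ∘-multiplier (mulBinomial-multiplier r 1) (mulLinears-multiplier rs)

  mulBinomials-multiplier : ∀ k κ b → IsMultiplier (mulBinomials k κ b)
  mulBinomials-multiplier zero    κ b = shiftBy-multiplier 0
  mulBinomials-multiplier (suc k) κ b =
    ∘-multiplier (mulBinomial-multiplier (κ zero) (b zero)) (mulBinomials-multiplier k (κ ∘ suc) (b ∘ suc))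

  commutes-mulLinears : ∀ {Φ} → IsMultiplier Φ → ∀ rs f → Φ (mulLinears rs f) ≋ mulLinears rs (Φ f)
  commutes-mulLinears Φ! []       f = ≋-refl
  commutes-mulLinears Φ! (r ∷ rs) f = ≋-trans (commutes-mulBinomial Φ! r 1 _)
    (cong (mulBinomial-multiplier r 1) (commutes-mulLinears Φ! rs f))

  mulLinears-++ : ∀ rs ss f → mulLinears (rs ++ ss) f ≡ mulLinears rs (mulLinears ss f)
  mulLinears-++ rs ss f = Listₚ.foldr-++ mulLinear f rs ss

  mulLinears-↭ : ∀ {rs ss} → rs ↭ ss → ∀ f → mulLinears rs f ≋ mulLinears ss f
  mulLinears-↭ ↭.refl            f = ≋-refl
  mulLinears-↭ (↭.prep r p)      f = cong (mulBinomial-multiplier r 1) (mulLinears-↭ p f)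
  mulLinears-↭ (↭.swap r r′ p)   f = ≋-trans
    (cong (mulBinomial-multiplier r 1) (cong (mulBinomial-multiplier r′ 1) (mulLinears-↭ p f)))
    (commutes-mulBinomial (mulBinomial-multiplier r 1) r′ 1 _)
  mulLinears-↭ (↭.trans p q)     f = ≋-trans (mulLinears-↭ p f) (mulLinears-↭ q f)

  mulLinears-pointwise : ∀ {rs ss} → Pointwise _≈_ rs ss → ∀ f → mulLinears rs f ≋ mulLinears ss f
  mulLinears-pointwise []             f = ≋-refl
  mulLinears-pointwise (r≈s ∷ rs≈ss) f n =
    +-cong (mulLinears-pointwise rs≈ss f n) (*-cong r≈s (cong shift-multiplier (mulLinears-pointwise rs≈ss f) n))

  infixl 7 _⊛_
  _⊛_ : Series → Series → Series
  (F ⊛ f) n = sum {suc n} λ i → F (toℕ i) * f (n ∸ toℕ i)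

  ⊛-multiplier : ∀ f → IsMultiplier (_⊛ f)
  ⊛-multiplier f = record
    { cong       = λ F≋G n → sum-cong-≋ {suc n} (λ i → *-congʳ {f (n ∸ toℕ i)} (F≋G (toℕ i)))
    ; homo-⊕     = λ F G n → trans (sum-cong-≋ {suc n} (λ i → distribʳ (f (n ∸ toℕ i)) (F (toℕ i)) (G (toℕ i))))
                                   (∑-distrib-+ {suc n} (λ i → F (toℕ i) * f (n ∸ toℕ i))
                                                        (λ i → G (toℕ i) * f (n ∸ toℕ i)))
    ; homo-scale = λ a F n → trans (sum-cong-≋ {suc n} (λ i → *-assoc a (F (toℕ i)) (f (n ∸ toℕ i))))
                                   (sym (*-distribˡ-sum {suc n} a (λ i → F (toℕ i) * f (n ∸ toℕ i))))
    ; homo-shift = λ { F zero    → trans (+-identityʳ _) (zeroˡ _)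
                     ; F (suc n) → trans (+-congʳ (zeroˡ _)) (+-identityˡ _) }
    }

  𝟙-⊛ : ∀ f → 𝟙 ⊛ f ≋ f
  𝟙-⊛ f n = trans (+-cong (*-identityˡ (f n)) (trans (sum-cong-≋ {n} (λ i → zeroˡ (f (n ∸ suc (toℕ i)))))
                                                     (sum-replicate-zero n)))
                  (+-identityʳ (f n))

  -- Both sides are convolution with their value at 𝟙.
  mulLinears≋mulBinomial : ∀ rs κ b → mulLinears rs 𝟙 ≋ mulBinomial κ b 𝟙 →
                           ∀ f → mulLinears rs f ≋ mulBinomial κ b f
  mulLinears≋mulBinomial rs κ b at𝟙 f = begin
    mulLinears rs f              ≈⟨ cong (mulLinears-multiplier rs) (𝟙-⊛ f) ⟨
    mulLinears rs (𝟙 ⊛ f)        ≈⟨ commutes-mulLinears (⊛-multiplier f) rs 𝟙 ⟨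
    mulLinears rs 𝟙 ⊛ f          ≈⟨ cong (⊛-multiplier f) at𝟙 ⟩
    mulBinomial κ b 𝟙 ⊛ f        ≈⟨ commutes-mulBinomial (⊛-multiplier f) κ b 𝟙 ⟩
    mulBinomial κ b (𝟙 ⊛ f)      ≈⟨ cong (mulBinomial-multiplier κ b) (𝟙-⊛ f) ⟩
    mulBinomial κ b f            ∎
    where open SetoidReasoning ≋-setoid

  Degree≤ : Series → ℕ → Set ℓ
  Degree≤ h D = ∀ n → D < n → h n ≈ 0#

  𝟙-degree : Degree≤ 𝟙 0
  𝟙-degree (suc n) _ = refl

  product : List Carrier → Carrier
  product = foldr _*_ 1#

  productFin : ∀ {k} → (Fin k → Carrier) → Carrier
  productFin = Vector.foldr _*_ 1#

  shiftBy-degree : ∀ b {h D} → Degree≤ h D → Degree≤ (shiftBy b h) (b ℕ.+ D)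
  shiftBy-degree b {h} {D} h≤D n b+D<n = trans (reflexive (shiftBy-≥ b h b≤n)) (h≤D (n ∸ b) D<n∸b)
    where
    b≤n : b ≤ n
    b≤n = ℕₚ.≤-trans (ℕₚ.m≤m+n b D) (ℕₚ.<⇒≤ b+D<n)
    D<n∸b : D < n ∸ b
    D<n∸b = ≡.subst (_< n ∸ b) (ℕₚ.m+n∸m≡n b D) (ℕₚ.∸-monoˡ-< b+D<n (ℕₚ.m≤m+n b D))

  module _ (κ : Carrier) (b : ℕ) {h : Series} {D : ℕ} (b≥1 : 1 ≤ b) (h≤D : Degree≤ h D) where

    mulBinomial-degree : Degree≤ (mulBinomial κ b h) (b ℕ.+ D)
    mulBinomial-degree n b+D<n =
      trans (+-cong (h≤D n (ℕₚ.≤-<-trans (ℕₚ.m≤n+m D b) b+D<n)) (*-congˡ (shiftBy-degree b h≤D n b+D<n)))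
            (trans (+-identityˡ _) (zeroʳ κ))

    mulBinomial-top : mulBinomial κ b h (b ℕ.+ D) ≈ κ * h D
    mulBinomial-top = begin
      h (b ℕ.+ D) + κ * shiftBy b h (b ℕ.+ D) ≡⟨ ≡.cong (λ x → h (b ℕ.+ D) + κ * x)
                                                  (≡.trans (shiftBy-≥ b h (ℕₚ.m≤m+n b D)) (≡.cong h (ℕₚ.m+n∸m≡n b D))) ⟩
      h (b ℕ.+ D) + κ * h D                   ≈⟨ +-congʳ (h≤D (b ℕ.+ D) (ℕₚ.m<n+m D b≥1)) ⟩
      0# + κ * h D                            ≈⟨ +-identityˡ _ ⟩
      κ * h D                                 ∎
      where open SetoidReasoning setoid

  mulLinears-degree : ∀ rs {h D} → Degree≤ h D → Degree≤ (mulLinears rs h) (length rs ℕ.+ D)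
  mulLinears-degree []       h≤D = h≤D
  mulLinears-degree (r ∷ rs) h≤D = mulBinomial-degree r 1 (s≤s z≤n) (mulLinears-degree rs h≤D)

  mulLinears-top : ∀ rs {h D} → Degree≤ h D → mulLinears rs h (length rs ℕ.+ D) ≈ product rs * h D
  mulLinears-top []       h≤D = sym (*-identityˡ _)
  mulLinears-top (r ∷ rs) h≤D = trans (mulBinomial-top r 1 (s≤s z≤n) (mulLinears-degree rs h≤D))
    (trans (*-congˡ (mulLinears-top rs h≤D)) (sym (*-assoc _ _ _)))

  mulBinomials-degree : ∀ k κ b {h D} → (∀ s → 1 ≤ b s) → Degree≤ h D →
                        Degree≤ (mulBinomials k κ b h) (sumFinℕ k b ℕ.+ D)
  mulBinomials-degree zero    κ b b≥1 h≤D = h≤D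
  mulBinomials-degree (suc k) κ b b≥1 h≤D =
    ≡.subst (Degree≤ _) (≡.sym (ℕₚ.+-assoc (b zero) (sumFinℕ k (b ∘ suc)) _))
      (mulBinomial-degree (κ zero) (b zero) (b≥1 zero) (mulBinomials-degree k (κ ∘ suc) (b ∘ suc) (b≥1 ∘ suc) h≤D))

  mulBinomials-top : ∀ k κ b {h D} → (∀ s → 1 ≤ b s) → Degree≤ h D →
                     mulBinomials k κ b h (sumFinℕ k b ℕ.+ D) ≈ productFin κ * h D
  mulBinomials-top zero    κ b b≥1 h≤D = sym (*-identityˡ _)
  mulBinomials-top (suc k) κ b {h} b≥1 h≤D = begin
    mulBinomials (suc k) κ b h (sumFinℕ (suc k) b ℕ.+ _)
      ≡⟨ ≡.cong (mulBinomials (suc k) κ b h) (ℕₚ.+-assoc (b zero) (sumFinℕ k (b ∘ suc)) _) ⟩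
    mulBinomial (κ zero) (b zero) (mulBinomials k (κ ∘ suc) (b ∘ suc) h) (b zero ℕ.+ (sumFinℕ k (b ∘ suc) ℕ.+ _))
      ≈⟨ mulBinomial-top (κ zero) (b zero) (b≥1 zero) (mulBinomials-degree k (κ ∘ suc) (b ∘ suc) (b≥1 ∘ suc) h≤D) ⟩
    κ zero * mulBinomials k (κ ∘ suc) (b ∘ suc) h (sumFinℕ k (b ∘ suc) ℕ.+ _)
      ≈⟨ *-congˡ (mulBinomials-top k (κ ∘ suc) (b ∘ suc) (b≥1 ∘ suc) h≤D) ⟩
    κ zero * (productFin (κ ∘ suc) * h _)
      ≈⟨ *-assoc _ _ _ ⟨
    productFin κ * h _ ∎
    where open SetoidReasoning setoid

  dilate : Carrier → Series → Series
  dilate ω f n = ω ^ n * f n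

  dilate-𝟙 : ∀ ω → dilate ω 𝟙 ≋ 𝟙
  dilate-𝟙 ω zero    = *-identityˡ 1#
  dilate-𝟙 ω (suc n) = zeroʳ _

  dilate-mulLinears : ∀ ω rs g → dilate ω (mulLinears rs g) ≋ mulLinears (map (ω *_) rs) (dilate ω g)
  dilate-mulLinears ω []       g = ≋-refl
  dilate-mulLinears ω (r ∷ rs) g = ≋-trans (dilate-mulLinear (mulLinears rs g))
    (cong (mulBinomial-multiplier (ω * r) 1) (dilate-mulLinears ω rs g))
    where
    open import Algebra.Solver.Ring.NaturalCoefficients.Default commutativeSemiring
    dilate-mulLinear : ∀ f → dilate ω (mulLinear r f) ≋ mulLinear (ω * r) (dilate ω f)
    dilate-mulLinear f zero    = solve 3 (λ a r w → con 1 :* (a :+ r :* con 0) := con 1 :* a :+ (w :* r) :* con 0)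
                                       refl (f 0) r ω
    dilate-mulLinear f (suc n) = solve 5 (λ w W a b r → (w :* W) :* (a :+ r :* b) := (w :* W) :* a :+ (w :* r) :* (W :* b))
                                       refl ω (ω ^ n) (f (suc n)) (f n) r

  𝟙-nonZero : ∀ n .{{_ : NonZero n}} → 𝟙 n ≡ 0#
  𝟙-nonZero (suc n) = ≡.refl

  mulLinears-at-0 : ∀ rs h → mulLinears rs h 0 ≈ h 0
  mulLinears-at-0 []       h = refl
  mulLinears-at-0 (r ∷ rs) h = trans (+-cong (mulLinears-at-0 rs h) (zeroʳ r)) (+-identityʳ _)

  binomial-shape : ∀ {F} b → 1 ≤ b → F 0 ≈ 1# → (∀ n → 1 ≤ n → n < b → F n ≈ 0#) → Degree≤ F b →
                   F ≋ mulBinomial (F b) b 𝟙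
  binomial-shape b b≥1 F0≈1 _ _ zero =
    trans F0≈1 (sym (trans (+-congˡ (trans (*-congˡ (reflexive (shiftBy-< b 𝟙 b≥1))) (zeroʳ _))) (+-identityʳ 1#)))
  binomial-shape {F} b b≥1 F0≈1 vanishes F≤b (suc m) with ℕₚ.<-cmp (suc m) b
  ... | tri< m<b _ _ = trans (vanishes (suc m) (s≤s z≤n) m<b)
    (sym (trans (+-congˡ (trans (*-congˡ (reflexive (shiftBy-< b 𝟙 m<b))) (zeroʳ _))) (+-identityˡ 0#)))
  ... | tri≈ _ ≡.refl _ = sym (trans (+-congˡ (*-congˡ (reflexive (shiftBy-diagonal b 𝟙))))
                                     (trans (+-identityˡ _) (*-identityʳ _)))
  ... | tri> _ _ b<m = trans (F≤b (suc m) b<m)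
    (sym (trans (+-congˡ (trans (*-congˡ (reflexive (≡.trans (shiftBy-≥ b 𝟙 (ℕₚ.<⇒≤ b<m))
                                                            (𝟙-nonZero _ {{ℕ.>-nonZero (ℕₚ.m<n⇒0<n∸m b<m)}}))))
                                (zeroʳ _)))
                (+-identityˡ 0#)))

module Cyclotomic {c ℓ} (R : CommutativeRing c ℓ) (domain : IsIntegralDomain R) where
  open CommutativeRing R hiding (zero)
  open Residues using (progression; residues)
  open Powers R using (^ℕ≡^)
  open Series R
  open IsMultiplier using (cong)
  open import Algebra.Properties.CommutativeSemiring.Exp commutativeSemiring using (_^_; ^-homo-*; ^-assocʳ)
  open import Algebra.Properties.Ring ring using (-‿distribˡ-*; -‿involutive; +-inverseˡ-unique)
  open import Algebra.Properties.CommutativeSemigroup *-commutativeSemigroup using (x∙yz≈y∙xz)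

  geometric : Carrier → Carrier → ℕ → List Carrier
  geometric v ω = applyUpTo (λ i → v * ω ^ i)

  applyUpTo-pointwise : ∀ {f g : ℕ → Carrier} → (∀ i → f i ≈ g i) → ∀ b →
                        Pointwise _≈_ (applyUpTo f b) (applyUpTo g b)
  applyUpTo-pointwise f≈g zero    = []
  applyUpTo-pointwise f≈g (suc b) = f≈g 0 ∷ applyUpTo-pointwise (f≈g ∘ suc) b

  module _ {b ω} (ω-primitive : IsPrimitiveRoot R b ω) where

    primitive-^≈1 : ω ^ b ≈ 1#
    primitive-^≈1 = trans (reflexive (≡.sym (^ℕ≡^ ω b))) (proj₁ ω-primitive)

    primitive-^≉1 : ∀ d → 1 ≤ d → d < b → ¬ ω ^ d ≈ 1#
    primitive-^≉1 d d≥1 d<b ω^d≈1 = proj₂ ω-primitive d d≥1 d<b (trans (reflexive (^ℕ≡^ ω d)) ω^d≈1)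

  primitive-power : ∀ {N ζ} → IsPrimitiveRoot R N ζ → ∀ d .{{_ : NonZero d}} b → d ℕ.* b ≡ N →
                    IsPrimitiveRoot R b (ζ ^ d)
  primitive-power {N} {ζ} ζ-primitive d b d*b≡N = ζ^d^b≈1 , ζ^d^i≉1
    where
    open SetoidReasoning setoid
    ζ^d^b≈1 : _^ℕ_ R (ζ ^ d) b ≈ 1#
    ζ^d^b≈1 = begin
      _^ℕ_ R (ζ ^ d) b  ≡⟨ ^ℕ≡^ (ζ ^ d) b ⟩
      (ζ ^ d) ^ b       ≈⟨ ^-assocʳ ζ d b ⟩
      ζ ^ (d ℕ.* b)     ≡⟨ ≡.cong (ζ ^_) d*b≡N ⟩
      ζ ^ N             ≈⟨ primitive-^≈1 ζ-primitive ⟩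
      1#                ∎
    ζ^d^i≉1 : ∀ i → 1 ≤ i → i < b → ¬ _^ℕ_ R (ζ ^ d) i ≈ 1#
    ζ^d^i≉1 i i≥1 i<b ζ^d^i≈1 = primitive-^≉1 ζ-primitive (d ℕ.* i)
      (ℕₚ.*-mono-≤ (ℕ.>-nonZero⁻¹ d) i≥1)
      (≡.subst (d ℕ.* i <_) d*b≡N (ℕₚ.*-monoʳ-< d i<b))
      (trans (sym (^-assocʳ ζ d i)) (trans (reflexive (≡.sym (^ℕ≡^ (ζ ^ d) i))) ζ^d^i≈1))

  -- F = ∏_{i ≤ b′} (1 - w ωⁱ X) is invariant under X ↦ ω X, so in an integral domain
  -- only its coefficients at 0 and suc b′ survive.
  module _ (w ω : Carrier) (b′ : ℕ) (ω-primitive : IsPrimitiveRoot R (suc b′) ω) where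
    private
      root : ℕ → Carrier
      root i = - w * ω ^ i

      roots : List Carrier
      roots = geometric (- w) ω (suc b′)

      F : Series
      F = mulLinears roots 𝟙

    -- multiplying every root by ω only rotates them
    roots-rotation : ∀ f → mulLinears (map (ω *_) roots) f ≋ mulLinears roots f
    roots-rotation f = begin
      mulLinears (map (ω *_) roots) f
        ≡⟨ ≡.cong (λ rs → mulLinears rs f) (Listₚ.map-applyUpTo root (ω *_) (suc b′)) ⟩
      mulLinears (applyUpTo ((ω *_) ∘ root) (suc b′)) f
        ≈⟨ mulLinears-pointwise {ss = applyUpTo (root ∘ suc) (suc b′)}
             (applyUpTo-pointwise (λ i → x∙yz≈y∙xz ω (- w) (ω ^ i)) (suc b′)) f ⟩
      mulLinears (applyUpTo (root ∘ suc) (suc b′)) f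
        ≡⟨ ≡.cong (λ rs → mulLinears rs f) (Listₚ.applyUpTo-∷ʳ (root ∘ suc) b′) ⟨
      mulLinears (applyUpTo (root ∘ suc) b′ ++ [ root (suc b′) ]) f
        ≈⟨ mulLinears-pointwise {ss = applyUpTo (root ∘ suc) b′ ++ [ root 0 ]}
             (Pointwise.++⁺ (Pointwise.refl refl) (*-congˡ (primitive-^≈1 ω-primitive) ∷ [])) f ⟩
      mulLinears (applyUpTo (root ∘ suc) b′ ++ [ root 0 ]) f
        ≈⟨ mulLinears-↭ (↭.↭-sym (↭ₚ.∷↭∷ʳ (root 0) (applyUpTo (root ∘ suc) b′))) f ⟩
      mulLinears roots f ∎
      where open SetoidReasoning ≋-setoid

    F-dilate : dilate ω F ≋ F
    F-dilate = ≋-trans (dilate-mulLinears ω roots 𝟙)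
      (≋-trans (cong (mulLinears-multiplier (map (ω *_) roots)) (dilate-𝟙 ω)) (roots-rotation 𝟙))

    [ω^n-1]Fn≈0 : ∀ n → (ω ^ n + - 1#) * F n ≈ 0#
    [ω^n-1]Fn≈0 n = trans (distribʳ _ _ _)
      (trans (+-cong (F-dilate n) (trans (sym (-‿distribˡ-* 1# (F n))) (-‿cong (*-identityˡ (F n)))))
             (-‿inverseʳ (F n)))

    F-vanishes : ∀ n → 1 ≤ n → n < suc b′ → F n ≈ 0#
    F-vanishes n n≥1 n<b with proj₂ domain (ω ^ n + - 1#) (F n) ([ω^n-1]Fn≈0 n)
    ... | inj₁ ω^n-1≈0 = ⊥-elim (primitive-^≉1 ω-primitive n n≥1 n<b
                                  (trans (+-inverseˡ-unique _ _ ω^n-1≈0) (-‿involutive 1#)))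
    ... | inj₂ Fn≈0    = Fn≈0

    F-degree : Degree≤ F (suc b′)
    F-degree = ≡.subst (Degree≤ F) (≡.trans (ℕₚ.+-identityʳ _) (Listₚ.length-applyUpTo root (suc b′)))
                       (mulLinears-degree roots 𝟙-degree)

    F-binomial : F ≋ mulBinomial (F (suc b′)) (suc b′) 𝟙
    F-binomial = binomial-shape (suc b′) (s≤s z≤n) (mulLinears-at-0 roots 𝟙) F-vanishes F-degree

    -- Apply both sides of F-binomial to the geometric series Σ wⁿ Xⁿ, which
    -- the factor 1 - w X of F sends to 𝟙.
    F-top : F (suc b′) ≈ - (w ^ suc b′)
    F-top = +-inverseˡ-unique _ _ (trans (+-comm _ _) (trans (sym at-b) vanishes-at-b))
      where
      γ : Series
      γ n = w ^ n
      rest : List Carrier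
      rest = applyUpTo (root ∘ suc) b′
      linear-γ : mulLinear (root 0) γ ≋ 𝟙
      linear-γ zero    = trans (+-congˡ (zeroʳ _)) (+-identityʳ 1#)
      linear-γ (suc n) = trans (+-congˡ (trans (*-congʳ (*-identityʳ (- w))) (sym (-‿distribˡ-* w _))))
                               (-‿inverseʳ _)
      vanishes-at-b : mulLinears roots γ (suc b′) ≈ 0#
      vanishes-at-b = trans (commutes-mulLinears (mulBinomial-multiplier (root 0) 1) rest γ (suc b′))
        (trans (cong (mulLinears-multiplier rest) linear-γ (suc b′))
               (mulLinears-degree rest 𝟙-degree (suc b′)
                 (≡.subst (_< suc b′) (≡.sym (≡.trans (ℕₚ.+-identityʳ _) (Listₚ.length-applyUpTo _ b′)))
                          (ℕₚ.n<1+n b′))))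
      at-b : mulLinears roots γ (suc b′) ≈ w ^ suc b′ + F (suc b′)
      at-b = trans (mulLinears≋mulBinomial roots (F (suc b′)) (suc b′) F-binomial γ (suc b′))
        (+-congˡ (trans (*-congˡ (reflexive (shiftBy-diagonal (suc b′) γ))) (*-identityʳ _)))

    mulLinears-geometric : ∀ f → mulLinears (geometric (- w) ω (suc b′)) f ≋ mulBinomial (- (w ^ suc b′)) (suc b′) f
    mulLinears-geometric = mulLinears≋mulBinomial roots (- (w ^ suc b′)) (suc b′)
      (≋-trans F-binomial (λ n → +-congˡ (*-congʳ F-top)))

  linearFactors : Carrier → List ℕ → List Carrier
  linearFactors ζ = map (λ t → - (ζ ^ t))

  mulLinears-progression : ∀ ζ a d b .{{_ : NonZero b}} → IsPrimitiveRoot R b (ζ ^ d) → ∀ f →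
    mulLinears (linearFactors ζ (progression a d b)) f ≋ mulBinomial (- ((ζ ^ a) ^ b)) b f
  mulLinears-progression ζ a d (suc b′) ζ^d-primitive f = begin
    mulLinears (linearFactors ζ (progression a d (suc b′))) f
      ≡⟨ ≡.cong (λ rs → mulLinears rs f) (Listₚ.map-applyUpTo (λ i → a ℕ.+ i ℕ.* d) (λ t → - (ζ ^ t)) (suc b′)) ⟩
    mulLinears (applyUpTo (λ i → - (ζ ^ (a ℕ.+ i ℕ.* d))) (suc b′)) f
      ≈⟨ mulLinears-pointwise {ss = geometric (- (ζ ^ a)) (ζ ^ d) (suc b′)}
                              (applyUpTo-pointwise split (suc b′)) f ⟩
    mulLinears (geometric (- (ζ ^ a)) (ζ ^ d) (suc b′)) f
      ≈⟨ mulLinears-geometric (ζ ^ a) (ζ ^ d) b′ ζ^d-primitive f ⟩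
    mulBinomial (- ((ζ ^ a) ^ suc b′)) (suc b′) f ∎
    where
    open SetoidReasoning ≋-setoid
    split : ∀ i → - (ζ ^ (a ℕ.+ i ℕ.* d)) ≈ - (ζ ^ a) * (ζ ^ d) ^ i
    split i = trans (-‿cong (trans (^-homo-* ζ a (i ℕ.* d))
                                   (*-congˡ (trans (reflexive (≡.cong (ζ ^_) (ℕₚ.*-comm i d)))
                                                   (sym (^-assocʳ ζ d i))))))
                    (-‿distribˡ-* _ _)

  mulLinears-residues : ∀ {N ζ} → IsPrimitiveRoot R N ζ → ∀ k (α n b : Fin k → ℕ) →
    (∀ s → NonZero (n s)) → (∀ s → NonZero (b s)) → (∀ s → n s ℕ.* b s ≡ N) → ∀ f →
    mulLinears (linearFactors ζ (residues k α n b)) f ≋ mulBinomials k (λ s → - ((ζ ^ α s) ^ b s)) b f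
  mulLinears-residues _ zero α n b _ _ _ f = ≋-refl
  mulLinears-residues {N} {ζ} ζ-primitive (suc k) α n b n≢0 b≢0 nb≡N f = begin
    mulLinears (linearFactors ζ (P ++ residues k (α ∘ suc) (n ∘ suc) (b ∘ suc))) f
      ≡⟨ ≡.cong (λ rs → mulLinears rs f) (Listₚ.map-++ (λ t → - (ζ ^ t)) P _) ⟩
    mulLinears (linearFactors ζ P ++ linearFactors ζ (Residues.residues k (α ∘ suc) (n ∘ suc) (b ∘ suc))) f
      ≡⟨ mulLinears-++ (linearFactors ζ P) _ f ⟩
    mulLinears (linearFactors ζ P) (mulLinears (linearFactors ζ (residues k (α ∘ suc) (n ∘ suc) (b ∘ suc))) f)
      ≈⟨ mulLinears-progression ζ (α zero) (n zero) (b zero) {{b≢0 zero}}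
           (primitive-power ζ-primitive (n zero) {{n≢0 zero}} (b zero) (nb≡N zero)) _ ⟩
    mulBinomial (- ((ζ ^ α zero) ^ b zero)) (b zero)
      (mulLinears (linearFactors ζ (residues k (α ∘ suc) (n ∘ suc) (b ∘ suc))) f)
      ≈⟨ cong (mulBinomial-multiplier _ (b zero))
              (mulLinears-residues ζ-primitive k (α ∘ suc) (n ∘ suc) (b ∘ suc)
                                   (n≢0 ∘ suc) (b≢0 ∘ suc) (nb≡N ∘ suc) f) ⟩
    mulBinomials (suc k) (λ s → - ((ζ ^ α s) ^ b s)) b f ∎
    where
    open SetoidReasoning ≋-setoid
    P : List ℕ
    P = progression (α zero) (n zero) (b zero)

module SumList {c ℓ} (R : CommutativeRing c ℓ) where
  open CommutativeRing R hiding (zero)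
  open import Data.List.Relation.Binary.Permutation.Setoid.Properties setoid using (foldr-commMonoid)

  sumList≡foldr : ∀ xs → sumList R xs ≡ foldr _+_ 0# xs
  sumList≡foldr []       = ≡.refl
  sumList≡foldr (x ∷ xs) = ≡.cong (x +_) (sumList≡foldr xs)

  sumList-↭ : ∀ {xs ys} → xs ↭ ys → sumList R xs ≈ sumList R ys
  sumList-↭ {xs} {ys} xs↭ys = begin
    sumList R xs     ≡⟨ sumList≡foldr xs ⟩
    foldr _+_ 0# xs  ≈⟨ foldr-commMonoid +-isCommutativeMonoid (↭.↭⇒↭ₛ′ isEquivalence xs↭ys) ⟩
    foldr _+_ 0# ys  ≡⟨ sumList≡foldr ys ⟨
    sumList R ys     ∎
    where open SetoidReasoning setoid

  sumList-++ : ∀ xs ys → sumList R (xs ++ ys) ≈ sumList R xs + sumList R ys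
  sumList-++ []       ys = sym (+-identityˡ _)
  sumList-++ (x ∷ xs) ys = trans (+-congˡ (sumList-++ xs ys)) (sym (+-assoc _ _ _))

  sumList-map-cong : ∀ {A : Set} {g h : A → Carrier} → (∀ x → g x ≈ h x) → ∀ xs →
                     sumList R (map g xs) ≈ sumList R (map h xs)
  sumList-map-cong g≈h []       = refl
  sumList-map-cong g≈h (x ∷ xs) = +-cong (g≈h x) (sumList-map-cong g≈h xs)

  sumList-map-scale : ∀ {A : Set} a (g : A → Carrier) xs →
                      sumList R (map (λ x → a * g x) xs) ≈ a * sumList R (map g xs)
  sumList-map-scale a g []       = sym (zeroʳ a)
  sumList-map-scale a g (x ∷ xs) = trans (+-congˡ (sumList-map-scale a g xs)) (sym (distribˡ a _ _))

module GeneratingFunction {c ℓ} (R : CommutativeRing c ℓ) where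
  open CommutativeRing R hiding (zero)
  open import Algebra.Properties.CommutativeSemiring.Exp commutativeSemiring using (_^_; ^-homo-*; ^-assocʳ)
  open Congruences using (exponent)
  open import Algebra.Properties.Ring ring using (-‿distribˡ-*)
  open Series R
  open IsMultiplier using (cong; homo-scale; homo-shiftBy; commutes-mulBinomial)
  open SumList R
  open Solutions

  monomial : ∀ {k} → (Fin k → Carrier) → Vec ℕ k → Carrier
  monomial c []      = 1#
  monomial c (x ∷ m) = c zero ^ x * monomial (c ∘ suc) m

  monomial-power : ∀ ζ k α b m → monomial (λ s → (ζ ^ α s) ^ b s) m ≈ ζ ^ exponent k α b m
  monomial-power ζ zero    α b []      = refl
  monomial-power ζ (suc k) α b (x ∷ m) = begin
    ((ζ ^ α zero) ^ b zero) ^ x * monomial _ m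
      ≈⟨ *-cong head≈ (monomial-power ζ k (α ∘ suc) (b ∘ suc) m) ⟩
    ζ ^ (α zero ℕ.* (x ℕ.* b zero)) * ζ ^ exponent k (α ∘ suc) (b ∘ suc) m
      ≈⟨ ^-homo-* ζ (α zero ℕ.* (x ℕ.* b zero)) (exponent k (α ∘ suc) (b ∘ suc) m) ⟨
    ζ ^ exponent (suc k) α b (x ∷ m) ∎
    where
    open SetoidReasoning setoid
    head≈ : ((ζ ^ α zero) ^ b zero) ^ x ≈ ζ ^ (α zero ℕ.* (x ℕ.* b zero))
    head≈ = trans (^-assocʳ (ζ ^ α zero) (b zero) x)
      (trans (^-assocʳ ζ (α zero) (b zero ℕ.* x))
             (reflexive (≡.cong (λ e → ζ ^ (α zero ℕ.* e)) (ℕₚ.*-comm (b zero) x))))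

  -- the series ∏_s c_s X^(b s) / (1 - c_s X^(b s)), see mulBinomials-generating
  generating : (k : ℕ) → (Fin k → ℕ) → (Fin k → Carrier) → Series
  generating k b c j = sumList R (map (monomial c) (solutions j k b j))

  generating-fuel : ∀ F k b c → (∀ s → 1 ≤ b s) → ∀ j → j ≤ F →
                    sumList R (map (monomial c) (solutions F k b j)) ≈ generating k b c j
  generating-fuel F k b c b≥1 j j≤F =
    sumList-↭ (↭ₚ.map⁺ (monomial c) (solutions-fuel-↭ F j k b b≥1 j j≤F ℕₚ.≤-refl))

  generating-zero : ∀ b c → generating zero b c ≋ 𝟙
  generating-zero b c zero    = +-identityʳ 1#
  generating-zero b c (suc j) = refl

  generating-below : ∀ k b c j → j < b zero → generating (suc k) b c j ≈ 0#
  generating-below k b c zero    _     = refl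
  generating-below k b c (suc j) j<b₀ with b zero ≤? suc j
  ... | no  _    = refl
  ... | yes b₀≤j = ⊥-elim (ℕₚ.<⇒≱ j<b₀ b₀≤j)

  generating-step : ∀ k b c → (∀ s → 1 ≤ b s) → ∀ j → b zero ≤ j →
                    generating (suc k) b c j ≈
                    c zero * generating k (b ∘ suc) (c ∘ suc) (j ∸ b zero)
                      + c zero * generating (suc k) b c (j ∸ b zero)
  generating-step k b c b≥1 zero    b₀≤0 = ⊥-elim (ℕₚ.<⇒≱ (b≥1 zero) b₀≤0)
  generating-step k b c b≥1 (suc F) b₀≤j with b zero ≤? suc F
  ... | no b₀≰j = ⊥-elim (b₀≰j b₀≤j)
  ... | yes _   = begin
    sumList R (map M (map (1 ∷_) X ++ map incrementHead Y))
      ≡⟨ ≡.cong (sumList R) (Listₚ.map-++ M (map (1 ∷_) X) (map incrementHead Y)) ⟩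
    sumList R (map M (map (1 ∷_) X) ++ map M (map incrementHead Y))
      ≈⟨ sumList-++ (map M (map (1 ∷_) X)) (map M (map incrementHead Y)) ⟩
    sumList R (map M (map (1 ∷_) X)) + sumList R (map M (map incrementHead Y))
      ≡⟨ ≡.cong₂ _+_ (≡.cong (sumList R) (Listₚ.map-∘ X)) (≡.cong (sumList R) (Listₚ.map-∘ Y)) ⟨
    sumList R (map (M ∘ (1 ∷_)) X) + sumList R (map (M ∘ incrementHead) Y)
      ≈⟨ +-cong (sumList-map-cong (λ _ → *-congʳ (*-identityʳ (c zero))) X)
                (sumList-map-cong (λ { (x ∷ m) → *-assoc (c zero) (c zero ^ x) _ }) Y) ⟩
    sumList R (map (λ m → c zero * M′ m) X) + sumList R (map (λ m → c zero * M m) Y)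
      ≈⟨ +-cong (sumList-map-scale (c zero) M′ X) (sumList-map-scale (c zero) M Y) ⟩
    c zero * sumList R (map M′ X) + c zero * sumList R (map M Y)
      ≈⟨ +-cong (*-congˡ (generating-fuel F k (b ∘ suc) (c ∘ suc) (b≥1 ∘ suc) _ j∸b₀≤F))
                (*-congˡ (generating-fuel F (suc k) b c b≥1 _ j∸b₀≤F)) ⟩
    c zero * generating k (b ∘ suc) (c ∘ suc) (suc F ∸ b zero)
      + c zero * generating (suc k) b c (suc F ∸ b zero) ∎
    where
    open SetoidReasoning setoid
    M : Vec ℕ (suc k) → Carrier
    M = monomial c
    M′ : Vec ℕ k → Carrier
    M′ = monomial (c ∘ suc)
    X : List (Vec ℕ k)
    X = solutions F k (b ∘ suc) (suc F ∸ b zero)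
    Y : List (Vec ℕ (suc k))
    Y = solutions F (suc k) b (suc F ∸ b zero)
    j∸b₀≤F : suc F ∸ b zero ≤ F
    j∸b₀≤F = fuel-decreases (b≥1 zero) b₀≤j ℕₚ.≤-refl

  mulBinomial-generating : ∀ k b c → (∀ s → 1 ≤ b s) →
    mulBinomial (- c zero) (b zero) (generating (suc k) b c) ≋
    scale (c zero) (shiftBy (b zero) (generating k (b ∘ suc) (c ∘ suc)))
  mulBinomial-generating k b c b≥1 n with b zero ≤? n
  ... | no b₀≰n = begin
    G n + - c zero * shiftBy (b zero) G n
      ≈⟨ +-cong (generating-below k b c n n<b₀) (*-congˡ (reflexive (shiftBy-< (b zero) G n<b₀))) ⟩
    0# + - c zero * 0#
      ≈⟨ trans (+-identityˡ _) (zeroʳ _) ⟩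
    0#
      ≈⟨ trans (*-congˡ (reflexive (shiftBy-< (b zero) G′ n<b₀))) (zeroʳ _) ⟨
    c zero * shiftBy (b zero) G′ n ∎
    where
    open SetoidReasoning setoid
    G G′ : Series
    G  = generating (suc k) b c
    G′ = generating k (b ∘ suc) (c ∘ suc)
    n<b₀ : n < b zero
    n<b₀ = ℕₚ.≰⇒> b₀≰n
  ... | yes b₀≤n = begin
    G n + - c zero * shiftBy (b zero) G n
      ≈⟨ +-cong (generating-step k b c b≥1 n b₀≤n) (*-congˡ (reflexive (shiftBy-≥ (b zero) G b₀≤n))) ⟩
    (c zero * G′ (n ∸ b zero) + c zero * G (n ∸ b zero)) + - c zero * G (n ∸ b zero)
      ≈⟨ +-congˡ (sym (-‿distribˡ-* (c zero) _)) ⟩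
    (c zero * G′ (n ∸ b zero) + c zero * G (n ∸ b zero)) + - (c zero * G (n ∸ b zero))
      ≈⟨ trans (+-assoc _ _ _) (trans (+-congˡ (-‿inverseʳ _)) (+-identityʳ _)) ⟩
    c zero * G′ (n ∸ b zero)
      ≡⟨ ≡.cong (c zero *_) (shiftBy-≥ (b zero) G′ b₀≤n) ⟨
    c zero * shiftBy (b zero) G′ n ∎
    where
    open SetoidReasoning setoid
    G G′ : Series
    G  = generating (suc k) b c
    G′ = generating k (b ∘ suc) (c ∘ suc)

  mulBinomials-generating : ∀ k b c → (∀ s → 1 ≤ b s) →
    mulBinomials k (λ s → - c s) b (generating k b c) ≋ scale (productFin c) (shiftBy (sumFinℕ k b) 𝟙)
  mulBinomials-generating zero    b c b≥1 n = trans (generating-zero b c n) (sym (*-identityˡ _))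
  mulBinomials-generating (suc k) b c b≥1 = begin
    mulBinomial (- c zero) (b zero) (Π′ G)
      ≈⟨ commutes-mulBinomial Π′! (- c zero) (b zero) G ⟨
    Π′ (mulBinomial (- c zero) (b zero) G)
      ≈⟨ cong Π′! (mulBinomial-generating k b c b≥1) ⟩
    Π′ (scale (c zero) (shiftBy (b zero) G′))
      ≈⟨ ≋-trans (homo-scale Π′! (c zero) _) (λ n → *-congˡ (homo-shiftBy Π′! (b zero) G′ n)) ⟩
    scale (c zero) (shiftBy (b zero) (Π′ G′))
      ≈⟨ (λ n → *-congˡ (cong (shiftBy-multiplier (b zero))
                              (mulBinomials-generating k (b ∘ suc) (c ∘ suc) (b≥1 ∘ suc)) n)) ⟩
    scale (c zero) (shiftBy (b zero) (scale (productFin (c ∘ suc)) (shiftBy (sumFinℕ k (b ∘ suc)) 𝟙)))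
      ≈⟨ (λ n → *-congˡ (homo-scale (shiftBy-multiplier (b zero)) _ _ n)) ⟩
    scale (c zero) (scale (productFin (c ∘ suc)) (shiftBy (b zero) (shiftBy (sumFinℕ k (b ∘ suc)) 𝟙)))
      ≈⟨ (λ n → trans (sym (*-assoc _ _ _)) (*-congˡ (reflexive (≡.cong (λ f → f n) (shiftBy-+ (b zero) _ 𝟙))))) ⟩
    scale (productFin c) (shiftBy (sumFinℕ (suc k) b) 𝟙) ∎
    where
    open SetoidReasoning ≋-setoid
    Π′ : Series → Series
    Π′ = mulBinomials k (λ s → - c (suc s)) (b ∘ suc)
    Π′! : IsMultiplier Π′
    Π′! = mulBinomials-multiplier k (λ s → - c (suc s)) (b ∘ suc)
    G G′ : Series
    G  = generating (suc k) b c
    G′ = generating k (b ∘ suc) (c ∘ suc)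

module Signs {c ℓ} (R : CommutativeRing c ℓ) where
  open CommutativeRing R hiding (zero)
  open import Algebra.Properties.CommutativeSemiring.Exp commutativeSemiring using (_^_)
  open import Algebra.Properties.Ring ring using (-1*x≈-x; -‿involutive)
  open import Algebra.Properties.CommutativeSemigroup *-commutativeSemigroup using (interchange)
  open import Algebra.Solver.Ring.NaturalCoefficients.Default commutativeSemiring
  open Series R using (productFin)

  -1*-1≈1 : - 1# * - 1# ≈ 1#
  -1*-1≈1 = trans (-1*x≈-x (- 1#)) (-‿involutive 1#)

  sign*sign≈1 : ∀ k → (- 1#) ^ k * (- 1#) ^ k ≈ 1#
  sign*sign≈1 zero    = *-identityˡ 1#
  sign*sign≈1 (suc k) = trans (interchange _ _ _ _) (trans (*-cong -1*-1≈1 (sign*sign≈1 k)) (*-identityˡ 1#))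

  productFin-neg : ∀ k (c : Fin k → Carrier) → productFin (λ s → - c s) ≈ (- 1#) ^ k * productFin c
  productFin-neg zero    c = sym (*-identityˡ 1#)
  productFin-neg (suc k) c = trans (*-cong (sym (-1*x≈-x (c zero))) (productFin-neg k (c ∘ suc)))
                                   (interchange _ _ _ _)

  sign-cancel : ∀ k′ x → x * (- 1#) ^ suc k′ ≈ - 1# → x ≈ (- 1#) ^ k′
  sign-cancel k′ x x*sign≈-1 = begin
    x                        ≈⟨ *-identityʳ x ⟨
    x * 1#                   ≈⟨ *-congˡ (trans (*-cong -1*-1≈1 (sign*sign≈1 k′)) (*-identityˡ 1#)) ⟨
    x * ((m * m) * (u * u))  ≈⟨ solve 3 (λ x m u → x :* ((m :* m) :* (u :* u)) := (x :* (m :* u)) :* (m :* u))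
                                        refl x m u ⟩
    (x * (m * u)) * (m * u)  ≈⟨ *-congʳ x*sign≈-1 ⟩
    m * (m * u)              ≈⟨ *-assoc m m u ⟨
    (m * m) * u              ≈⟨ trans (*-congʳ -1*-1≈1) (*-identityˡ u) ⟩
    u                        ∎
    where
    open SetoidReasoning setoid
    m u : Carrier
    m = - 1#
    u = (- 1#) ^ k′

module SolutionSum {r ℓ} (R : CommutativeRing r ℓ) (domain : IsIntegralDomain R)
  (k′ : ℕ) (α n b : Fin (suc k′) → ℕ) (N : ℕ) .{{_ : NonZero N}}
  (ζ : CommutativeRing.Carrier R) (ζ-primitive : IsPrimitiveRoot R N ζ)
  (α<n : ∀ s → α s < n s) (nb≡N : ∀ s → n s ℕ.* b s ≡ N)
  (disjoint : Residues.DisjointProgressions (suc k′) α n b) where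

  open CommutativeRing R hiding (zero)
  open import Algebra.Properties.CommutativeSemiring.Exp commutativeSemiring using (_^_; ^-assocʳ)
  open import Algebra.Solver.Ring.NaturalCoefficients.Default commutativeSemiring
  open Series R
  open IsMultiplier using (cong)
  open Cyclotomic R domain
  open GeneratingFunction R
  open Signs R
  open Residues

  k : ℕ
  k = suc k′

  c : Fin k → Carrier
  c s = (ζ ^ α s) ^ b s

  n≢0 : ∀ s → NonZero (n s)
  n≢0 s = ℕ.>-nonZero (ℕₚ.≤-<-trans z≤n (α<n s))

  b≢0 : ∀ s → NonZero (b s)
  b≢0 s = nonZero-factorʳ (n s) (nb≡N s)

  b≥1 : ∀ s → 1 ≤ b s
  b≥1 s = ℕ.>-nonZero⁻¹ (b s) {{b≢0 s}}

  B : ℕ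
  B = sumFinℕ k b

  Π : Series → Series
  Π = mulBinomials k (λ s → - c s) b

  ts : List ℕ
  ts = residues k α n b

  qs : List Carrier
  qs = linearFactors ζ (complement (progression 0 1 N) ts)

  -- 1 - X^N = ∏_{t < N} (1 - ζ^t X), and the t in the classes α s (n s) contribute Π.
  factorisation : ∀ f → mulBinomial (- 1#) N f ≋ mulLinears qs (Π f)
  factorisation f = begin
    mulBinomial (- 1#) N f
      ≈⟨ (λ j → +-congˡ (*-congʳ (-‿cong (^-assocʳ ζ 0 N)))) ⟨
    mulBinomial (- ((ζ ^ 0) ^ N)) N f
      ≈⟨ mulLinears-progression ζ 0 1 N (primitive-power ζ-primitive 1 N (ℕₚ.*-identityˡ N)) f ⟨
    mulLinears (linearFactors ζ (progression 0 1 N)) f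
      ≈⟨ mulLinears-↭ (↭ₚ.map⁺ _ (↭-complement (progression-unique 0 1 N)
                                               (residues-unique k α n b n≢0 disjoint)
                                               (residues-⊆ k α n b N α<n nb≡N))) f ⟩
    mulLinears (linearFactors ζ (complement (progression 0 1 N) ts ++ ts)) f
      ≡⟨ ≡.cong (λ rs → mulLinears rs f) (Listₚ.map-++ (λ t → - (ζ ^ t)) (complement (progression 0 1 N) ts) ts) ⟩
    mulLinears (qs ++ linearFactors ζ ts) f
      ≡⟨ mulLinears-++ qs (linearFactors ζ ts) f ⟩
    mulLinears qs (mulLinears (linearFactors ζ ts) f)
      ≈⟨ cong (mulLinears-multiplier qs) (mulLinears-residues ζ-primitive k α n b n≢0 b≢0 nb≡N f) ⟩
    mulLinears qs (Π f) ∎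
    where open SetoidReasoning ≋-setoid

  N≡length+B : N ≡ length qs ℕ.+ B
  N≡length+B = begin
    N                                                      ≡⟨ Listₚ.length-applyUpTo _ N ⟨
    length (progression 0 1 N)                             ≡⟨ ↭ₚ.↭-length (↭-complement (progression-unique 0 1 N)
                                                                (residues-unique k α n b n≢0 disjoint)
                                                                (residues-⊆ k α n b N α<n nb≡N)) ⟩
    length (complement (progression 0 1 N) ts ++ ts)       ≡⟨ Listₚ.length-++ (complement (progression 0 1 N) ts) ⟩
    length (complement (progression 0 1 N) ts) ℕ.+ length ts
      ≡⟨ ≡.cong₂ ℕ._+_ (≡.sym (Listₚ.length-map _ (complement (progression 0 1 N) ts))) (length-residues k α n b) ⟩
    length qs ℕ.+ B                                        ∎
    where open ≡.≡-Reasoning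

  coefficient-N : ∀ h → Degree≤ h B → mulLinears qs h N ≈ product qs * h B
  coefficient-N h h≤B = trans (reflexive (≡.cong (mulLinears qs h) N≡length+B)) (mulLinears-top qs h≤B)

  generating-at-N≈product : generating k b c N ≈ product qs * productFin c
  generating-at-N≈product = begin
    G N
      ≈⟨ trans (+-congˡ (trans (*-congˡ (trans (reflexive (shiftBy-diagonal N G)) G0≈0)) (zeroʳ _)))
               (+-identityʳ _) ⟨
    mulBinomial (- 1#) N G N
      ≈⟨ factorisation G N ⟩
    mulLinears qs (Π G) N
      ≈⟨ cong (mulLinears-multiplier qs) (mulBinomials-generating k b c b≥1) N ⟩
    mulLinears qs (scale (productFin c) (shiftBy B 𝟙)) N
      ≈⟨ coefficient-N _ (λ j B<j → trans (*-congˡ (X^B-degree j B<j)) (zeroʳ _)) ⟩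
    product qs * (productFin c * shiftBy B 𝟙 B)
      ≈⟨ *-congˡ (trans (*-congˡ (reflexive (shiftBy-diagonal B 𝟙))) (*-identityʳ _)) ⟩
    product qs * productFin c ∎
    where
    open SetoidReasoning setoid
    G : Series
    G = generating k b c
    G0≈0 : G 0 ≈ 0#
    G0≈0 = generating-below k′ b c 0 (b≥1 zero)
    X^B-degree : Degree≤ (shiftBy B 𝟙) B
    X^B-degree = ≡.subst (Degree≤ _) (ℕₚ.+-identityʳ B) (shiftBy-degree B 𝟙-degree)

  -1≈product : - 1# ≈ product qs * productFin (λ s → - c s)
  -1≈product = begin
    - 1#
      ≈⟨ trans (+-cong (reflexive (𝟙-nonZero N)) (*-congˡ (reflexive (shiftBy-diagonal N 𝟙))))
               (trans (+-identityˡ _) (*-identityʳ _)) ⟨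
    mulBinomial (- 1#) N 𝟙 N
      ≈⟨ factorisation 𝟙 N ⟩
    mulLinears qs (Π 𝟙) N
      ≈⟨ coefficient-N (Π 𝟙) (≡.subst (Degree≤ _) (ℕₚ.+-identityʳ B)
                                      (mulBinomials-degree k (λ s → - c s) b b≥1 𝟙-degree)) ⟩
    product qs * Π 𝟙 B
      ≈⟨ *-congˡ (trans (reflexive (≡.cong (Π 𝟙) (≡.sym (ℕₚ.+-identityʳ B))))
                        (trans (mulBinomials-top k (λ s → - c s) b b≥1 𝟙-degree) (*-identityʳ _))) ⟩
    product qs * productFin (λ s → - c s) ∎
    where open SetoidReasoning setoid

  generating-at-N : generating k b c N ≈ (- 1#) ^ k′
  generating-at-N = trans generating-at-N≈product (sign-cancel k′ _ (begin
    (product qs * productFin c) * (- 1#) ^ k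
      ≈⟨ solve 3 (λ p c s → (p :* c) :* s := p :* (s :* c)) refl (product qs) (productFin c) ((- 1#) ^ k) ⟩
    product qs * ((- 1#) ^ k * productFin c)
      ≈⟨ *-congˡ (productFin-neg k c) ⟨
    product qs * productFin (λ s → - c s)
      ≈⟨ -1≈product ⟨
    - 1# ∎))
    where open SetoidReasoning setoid

prodFin-nonZero : ∀ k (n : Fin k → ℕ) → (∀ s → NonZero (n s)) → NonZero (prodFin k n)
prodFin-nonZero zero    n nz = _
prodFin-nonZero (suc k) n nz =
  ℕₚ.m*n≢0 (n zero) (prodFin k (n ∘ suc)) {{nz zero}} {{prodFin-nonZero k (n ∘ suc) (nz ∘ suc)}}

∣-prodFin : ∀ k (n : Fin k → ℕ) s → n s ℕ∣.∣ prodFin k n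
∣-prodFin (suc k) n zero    = ℕ∣.m∣m*n (prodFin k (n ∘ suc))
∣-prodFin (suc k) n (suc s) = ℕ∣.∣n⇒∣m*n (n zero) (∣-prodFin k (n ∘ suc) s)

module Reduction (k : ℕ) (a : Fin k → ℤ) (n : Fin k → ℕ) (nz : ∀ s → NonZero (n s)) where
  open import Data.Integer using (+_)
  open import Data.Integer.DivMod using (_%ℕ_; _/ℕ_; a≡a%ℕn+[a/ℕn]*n; n%ℕd<d)
  open import Data.Nat.DivMod using (_/_; m*[n/m]≡n)
  open Solutions
  open Residues using (DisjointProgressions)
  open Rational using (IsSolution⇔Solution)

  N : ℕ
  N = prodFin k n

  instance
    N-nonZero : NonZero N
    N-nonZero = prodFin-nonZero k n nz

  b α : Fin k → ℕ
  b s = (N / n s) {{nz s}}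
  α s = (a s %ℕ n s) {{nz s}}

  q : Fin k → ℤ
  q s = (a s /ℕ n s) {{nz s}}

  nb≡N : ∀ s → n s ℕ.* b s ≡ N
  nb≡N s = m*[n/m]≡n {{nz s}} (∣-prodFin k n s)

  a≡α+qn : ∀ s → a s ≡ + α s ℤ.+ q s ℤ.* + n s
  a≡α+qn s = a≡a%ℕn+[a/ℕn]*n (a s) (n s) {{nz s}}

  α<n : ∀ s → α s < n s
  α<n s = n%ℕd<d (a s) (n s) {{nz s}}

  b≥1 : ∀ s → 1 ≤ b s
  b≥1 s = ℕ.>-nonZero⁻¹ (b s) {{nonZero-factorʳ (n s) (nb≡N s)}}

  ∈-class : ∀ s i → _≡_[mod_] (+ (α s ℕ.+ i ℕ.* n s)) (a s) (n s)
  ∈-class s i = ℕ∣.divides ℤ.∣ + i ℤ.- q s ∣ (≡.trans (≡.cong ℤ.∣_∣ (begin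
    + (α s ℕ.+ i ℕ.* n s) ℤ.- a s
      ≡⟨ ≡.cong₂ ℤ._-_ (≡.trans (ℤₚ.pos-+ (α s) _) (≡.cong (λ x → + α s ℤ.+ x) (ℤₚ.pos-* i (n s)))) (a≡α+qn s) ⟩
    (+ α s ℤ.+ + i ℤ.* + n s) ℤ.- (+ α s ℤ.+ q s ℤ.* + n s)
      ≡⟨ solve 4 (λ A I Q n → (A :+ I :* n) :- (A :+ Q :* n) := (I :- Q) :* n) ≡.refl (+ α s) (+ i) (q s) (+ n s) ⟩
    (+ i ℤ.- q s) ℤ.* + n s ∎)) (ℤₚ.abs-* (+ i ℤ.- q s) (+ n s)))
    where
    open ≡.≡-Reasoning
    open ℤ-Solver.+-*-Solver

  disjoint-progressions : PairwiseDisjoint k a n → DisjointProgressions k α n b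
  disjoint-progressions disjoint s r i j _ _ eq =
    disjoint s r (+ (α s ℕ.+ i ℕ.* n s)) (∈-class s i)
             (≡.subst (λ x → _≡_[mod_] (+ x) (a r) (n r)) (≡.sym eq) (∈-class r j))

  ↭-solutions : ∀ {L} → Unique L → (∀ m → (m ∈ L) ⇔ IsSolution k n nz m) → L ↭ solutions N k b N
  ↭-solutions {L} L! L⇔ = unique-↭ L! (solutions-unique N k b N) λ m → mk⇔
    (λ m∈L → solutions-complete N k b b≥1 N ℕₚ.≤-refl m (Equivalence.to (IsSolution⇔Solution k n nz b N nb≡N m)
                                                                       (Equivalence.to (L⇔ m) m∈L)))
    (λ m∈ → Equivalence.from (L⇔ m) (Equivalence.from (IsSolution⇔Solution k n nz b N nb≡N m)
                                                      (solutions-sound N k b N m m∈)))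

  module _ {c ℓ} (R : CommutativeRing c ℓ) where
    open CommutativeRing R hiding (zero)
    open import Algebra.Properties.CommutativeSemiring.Exp commutativeSemiring using (_^_)
    open Congruences
    open Powers R
    open GeneratingFunction R using (monomial; monomial-power)

    termList≡map : ∀ ζ L → termList R k a n nz ζ L ≡ map (term R k a n nz ζ) L
    termList≡map ζ []      = ≡.refl
    termList≡map ζ (m ∷ L) = ≡.cong (term R k a n nz ζ m ∷_) (termList≡map ζ L)

    term≈monomial : ∀ ζ → ζ ^ N ≈ 1# → ∀ m → term R k a n nz ζ m ≈ monomial (λ s → (ζ ^ α s) ^ b s) m
    term≈monomial ζ ζ^N≈1 m with exponent-congruent k a α q n b N a≡α+qn nb≡N m
    ... | Q , exponent≡ = trans (rootPow-congruent ζ^N≈1 _ _ Q exponent≡) (sym (monomial-power ζ k α b m))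

corollary1p5 : {c ℓ : Level} (R : CommutativeRing c ℓ) → IsIntegralDomain R →
    (k : ℕ) → 1 ≤ k → (a : Fin k → ℤ) → (n : Fin k → ℕ) → (nz : ∀ s → NonZero (n s)) →
    (ζ : CommutativeRing.Carrier R) → IsPrimitiveRoot R (prodFin k n) ζ →
    PairwiseDisjoint k a n →
    (L : List (Vec ℕ k)) → Unique L → (∀ m → (m ∈ L) ⇔ IsSolution k n nz m) →
    CommutativeRing._≈_ R (sumList R (termList R k a n nz ζ L))
      (_^ℕ_ R (CommutativeRing.-_ R (CommutativeRing.1# R)) (k ∸ 1))
corollary1p5 R domain (suc k′) _ a n nz ζ ζ-primitive disjoint L L! L⇔ = begin
  sumList R (termList R k a n nz ζ L)    ≡⟨ ≡.cong (sumList R) (termList≡map R ζ L) ⟩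
  sumList R (map (term R k a n nz ζ) L)  ≈⟨ sumList-map-cong (term≈monomial R ζ (primitive-^≈1 ζ-primitive)) L ⟩
  sumList R (map (monomial c) L)         ≈⟨ sumList-↭ (↭ₚ.map⁺ (monomial c) (↭-solutions L! L⇔)) ⟩
  generating k b c N                     ≈⟨ SolutionSum.generating-at-N R domain k′ α n b N ζ ζ-primitive
                                                                        α<n nb≡N (disjoint-progressions disjoint) ⟩
  (- 1#) ^ k′                            ≡⟨ ^ℕ≡^ (- 1#) k′ ⟨
  _^ℕ_ R (- 1#) k′                       ∎
  where
  k : ℕ
  k = suc k′
  open Reduction k a n nz
  open CommutativeRing R hiding (zero)
  open import Algebra.Properties.CommutativeSemiring.Exp commutativeSemiring using (_^_)
  open Powers R using (^ℕ≡^)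
  open Cyclotomic R domain using (primitive-^≈1)
  open SumList R
  open GeneratingFunction R using (monomial; generating)
  open SetoidReasoning setoid
  c : Fin k → Carrier
  c s = (ζ ^ α s) ^ b s
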